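{- For each $f\in\{\tfrac{16}{51},\tfrac{9}{28},\tfrac{28}{87},\tfrac{271}{841},\tfrac{31}{96},\tfrac{331}{1024},\tfrac{280}{841},\tfrac{341}{1024},\tfrac13,\tfrac{271}{812},\tfrac{11}{32},\tfrac{10}{29},\tfrac{6}{17}\}$, the entropy of ternary square-free words with fixed frequency $f$ of the letter $a$ is strictly positive.
   Context: Words are strings over $\{a,b,c\}$; a word is square-free if it contains no factor $yy$ with $y$ a nonempty word. For a word $w$, $|w|_a$ denotes the number of occurrences of $a$ in $w$. For $f\in[0,1]$, the entropy of ternary square-free words with frequency $f$ of the letter $a$ is $\lim_{\delta\to0^+}\liminf_{n\to\infty}\frac1n\log N_n(\delta)$, where $N_n(\delta)$ is the number of ternary square-free words $w$ of length $n$ with $\big||w|_a/n-f\big|<\delta$. -}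

module Defs where

open import Data.Nat using (ℕ; zero; suc; _+_; _*_; _^_; _≤_; _<_; ∣_-_∣)
open import Data.Fin using (Fin; zero; suc)
open import Data.List using (List; []; _∷_; _++_; length)
open import Data.List.Relation.Unary.All using (All)
open import Data.List.Relation.Unary.Unique.Propositional using (Unique)
open import Data.Product using (Σ; ∃; ∃-syntax; _×_; _,_)
open import Relation.Binary.PropositionalEquality using (_≡_; _≢_)
open import Relation.Nullary using (¬_)

Letter : Set
Letter = Fin 3

a : Letter
a = zero

Word : Set
Word = List Letter

HasSquare : Word → Set
HasSquare w = ∃[ u ] ∃[ y ] ∃[ v ] (y ≢ [] × w ≡ u ++ (y ++ (y ++ v)))

SquareFree : Word → Set
SquareFree w = ¬ HasSquare w

count-a : Word → ℕ
count-a [] = 0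
count-a (zero ∷ w) = suc (count-a w)
count-a (suc _ ∷ w) = count-a w

-- Word w of length n with | |w|_a / n - p/q | < 1/(suc m), i.e.
-- | q·|w|_a - p·n | · (suc m) < q · n   (cleared denominators, q, n > 0).
Good : (p q m n : ℕ) → Word → Set
Good p q m n w =
  length w ≡ n × SquareFree w × (∣ q * count-a w - p * n ∣ * suc m < q * n)

-- N_n(1/(suc m)) ≥ B : there are at least B distinct such words.
AtLeast : (p q m n B : ℕ) → Set
AtLeast p q m n B = ∃[ ws ] (Unique ws × All (Good p q m n) ws × B ≤ length ws)

-- Entropy with frequency p/q of the letter a is strictly positive.
-- Equivalent to: ∃ r = (k+2)/(k+1) > 1 such that for every
-- δ = 1/(m+1) there is N with N_n(δ) ≥ r^n for all n ≥ N.
PositiveEntropy : ℕ → ℕ → Set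
PositiveEntropy p q =
  ∃[ k ] ∀ (m : ℕ) → ∃[ N ] ∀ (n : ℕ) → N ≤ n →
    ∃[ B ] (AtLeast p q m n B × suc (suc k) ^ n ≤ B * suc k ^ n)

freqs : List (ℕ × ℕ)
freqs = (16 , 51) ∷ (9 , 28) ∷ (28 , 87) ∷ (271 , 841) ∷ (31 , 96)
      ∷ (331 , 1024) ∷ (280 , 841) ∷ (341 , 1024) ∷ (1 , 3)
      ∷ (271 , 812) ∷ (11 , 32) ∷ (10 , 29) ∷ (6 , 17) ∷ []

-- The words are prefixes of g(z), where z is a prefix of an iterate h^k(a) and g, h are uniform morphisms in which
-- every letter has two images, one chosen independently at each position. Such a morphism maps square-free words
-- to square-free words once finitely many conditions hold: a square of short period lies in the image of at most
-- four letters; the prefix of a block cannot occur across a block boundary, so a square of long period has a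
-- period that is a multiple of the block length, and markers at both ends of each block then recover a square in
-- the preimage. The discrepancy q·|w|_a − p·|w| is additive; every block of h has discrepancy 0 and g multiplies
-- discrepancies by a constant, so all words have discrepancy bounded independently of their length n, that is,
-- frequency of a within O(1 / n) of p / q. Distinct choices give distinct words, hence 2 ^ (n / Lg) words of
-- length n, which grows exponentially.
module Submission where

open import Defs
open import Data.Nat using (ℕ; zero; suc; _+_; _*_; _∸_; _^_; _⊓_; _⊔_; _≤_; _<_; _≤ᵇ_; _≡ᵇ_; z≤n; s≤s; s≤s⁻¹;
                            NonZero; >-nonZero; >-nonZero⁻¹; _≤?_; _<?_; ∣_-_∣)
open import Data.Nat.Properties
open import Data.Nat.DivMod using (_/_; _%_; m≡m%n+[m/n]*n; m%n<n; [m+kn]%n≡m%n)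
open import Data.Nat.Tactic.RingSolver using (solve-∀)
open import Data.Integer using (ℤ; 0ℤ; 1ℤ; _⊖_)
import Data.Integer as ℤ
import Data.Integer.Properties as ℤ
import Data.Integer.Tactic.RingSolver as ℤ-Solver
open import Data.Fin using (zero; suc)
import Data.Fin.Properties as Fin
open import Data.Bool using (Bool; true; false; T; _∧_; _∨_; not)
open import Data.Bool.Properties using (T-∧; T-∨)
open import Data.Vec using (Vec; []; _∷_)
import Data.Vec.Properties as Vec
open import Data.List using (List; []; _∷_; _++_; length; take; drop; map)
open import Data.List.Properties
  using (length-++; length-++-≤ˡ; length-map; length-take; length-drop; take++drop≡id; take-take; ++-assoc; ++-identityʳ;
         drop-drop; drop-[]; take-[]; drop-all)
import Data.List.Properties as List
open import Data.List.Membership.Propositional using (_∈_)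
open import Data.List.Membership.Propositional.Properties using (∈-map⁻)
open import Data.List.Relation.Unary.All as All using (All; []; _∷_)
import Data.List.Relation.Unary.All.Properties as All
open import Data.List.Relation.Unary.AllPairs using ([]; _∷_)
open import Data.List.Relation.Unary.Unique.Propositional using (Unique)
import Data.List.Relation.Unary.Unique.Propositional.Properties as Unique
open import Data.Product using (∃-syntax; _×_; _,_; proj₁; proj₂; uncurry)
open import Data.Sum using (inj₁; inj₂)
open import Data.Empty using (⊥; ⊥-elim)
open import Relation.Nullary using (¬_; Dec; yes; no; contradiction)
open import Relation.Nullary.Decidable using (decidable-stable)
open import Relation.Binary.PropositionalEquality
open import Function using (_∘_; _⟨_⟩_; _⇔_; mk⇔; Equivalence)

-- Words, positions and squares

at : {A : Set} → A → List A → ℕ → A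
at d []       _       = d
at d (x ∷ xs) zero    = x
at d (x ∷ xs) (suc i) = at d xs i

module _ {A : Set} (d : A) where

  at-++ˡ : ∀ (u v : List A) {i} → i < length u → at d (u ++ v) i ≡ at d u i
  at-++ˡ (x ∷ u) v {zero}  _         = refl
  at-++ˡ (x ∷ u) v {suc i} (s≤s i<) = at-++ˡ u v i<

  at-++ʳ : ∀ (u v : List A) i → at d (u ++ v) (length u + i) ≡ at d v i
  at-++ʳ []      v i = refl
  at-++ʳ (x ∷ u) v i = at-++ʳ u v i

  at-drop : ∀ k (w : List A) i → at d (drop k w) i ≡ at d w (k + i)
  at-drop zero    w       i = refl
  at-drop (suc k) []      i = refl
  at-drop (suc k) (x ∷ w) i = at-drop k w i

  at-take : ∀ k (w : List A) {i} → i < k → at d (take k w) i ≡ at d w i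
  at-take (suc k) []      _         = refl
  at-take (suc k) (x ∷ w) {zero}  _ = refl
  at-take (suc k) (x ∷ w) {suc i} (s≤s i<k) = at-take k w i<k

  at-injective : ∀ (u v : List A) → length u ≡ length v →
                 (∀ i → i < length u → at d u i ≡ at d v i) → u ≡ v
  at-injective []      []      _  _  = refl
  at-injective (x ∷ u) (y ∷ v) eq f =
    cong₂ _∷_ (f 0 (s≤s z≤n)) (at-injective u v (suc-injective eq) (λ i i< → f (suc i) (s≤s i<)))

_!_ : Word → ℕ → Letter
w ! i = at a w i

length-take-≤ : {A : Set} → ∀ k (w : List A) → k ≤ length w → length (take k w) ≡ k
length-take-≤ k w k≤ = trans (length-take k w) (m≤n⇒m⊓n≡m k≤)

drop-++ : {A : Set} (u v : List A) → drop (length u) (u ++ v) ≡ v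
drop-++ []      v = refl
drop-++ (x ∷ u) v = drop-++ u v

drop-++ˡ : {A : Set} (u v : List A) (i : ℕ) → drop (length u + i) (u ++ v) ≡ drop i v
drop-++ˡ []      v i = refl
drop-++ˡ (x ∷ u) v i = drop-++ˡ u v i

take-++ˡ : {A : Set} (u v : List A) (i : ℕ) → take (length u + i) (u ++ v) ≡ u ++ take i v
take-++ˡ []      v i = refl
take-++ˡ (x ∷ u) v i = cong (x ∷_) (take-++ˡ u v i)

take-++ʳ : {A : Set} (u v : List A) {i : ℕ} → i ≤ length u → take i (u ++ v) ≡ take i u
take-++ʳ u       v {zero}  _        = refl
take-++ʳ (x ∷ u) v {suc i} (s≤s i≤) = cong (x ∷_) (take-++ʳ u v i≤)

drop-++ʳ : {A : Set} (u v : List A) {i : ℕ} → i ≤ length u → drop i (u ++ v) ≡ drop i u ++ v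
drop-++ʳ u       v {zero}  _        = refl
drop-++ʳ (x ∷ u) v {suc i} (s≤s i≤) = drop-++ʳ u v i≤

record CommonPrefix (k : ℕ) (u v : Word) : Set where
  constructor common-prefix
  field
    ≤-lengthˡ : k ≤ length u
    ≤-lengthʳ : k ≤ length v
    agree     : ∀ j → j < k → u ! j ≡ v ! j

CommonPrefix⇒take≡take : ∀ {k u v} → CommonPrefix k u v → take k u ≡ take k v
CommonPrefix⇒take≡take {k} {u} {v} (common-prefix k≤u k≤v agree) =
  at-injective a (take k u) (take k v) (length-take-≤ k u k≤u ⟨ trans ⟩ sym (length-take-≤ k v k≤v)) λ j j< →
    let j<k = subst (j <_) (length-take-≤ k u k≤u) j< in
    at-take a k u j<k ⟨ trans ⟩ agree j j<k ⟨ trans ⟩ sym (at-take a k v j<k)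

CommonPrefix-++ : ∀ y r r′ → CommonPrefix (length y) (y ++ r) (y ++ r′)
CommonPrefix-++ y r r′ = common-prefix (length-++-≤ˡ y) (length-++-≤ˡ y) λ j j< →
  at-++ˡ a y r j< ⟨ trans ⟩ sym (at-++ˡ a y r′ j<)

CommonPrefix-++⁺ : ∀ {k u v} w → CommonPrefix k u v → CommonPrefix k (u ++ w) v
CommonPrefix-++⁺ {k} {u} w (common-prefix k≤u k≤v agree) =
  common-prefix (≤-trans k≤u (length-++-≤ˡ u)) k≤v λ j j<k → at-++ˡ a u w (<-≤-trans j<k k≤u) ⟨ trans ⟩ agree j j<k

CommonPrefix-++⁻ : ∀ {k u v} w → k ≤ length u → CommonPrefix k (u ++ w) v → CommonPrefix k u v
CommonPrefix-++⁻ {k} {u} w k≤u (common-prefix _ k≤v agree) =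
  common-prefix k≤u k≤v λ j j<k → sym (at-++ˡ a u w (<-≤-trans j<k k≤u)) ⟨ trans ⟩ agree j j<k

CommonPrefix-refl : ∀ {k u} → k ≤ length u → CommonPrefix k u u
CommonPrefix-refl k≤u = common-prefix k≤u k≤u λ _ _ → refl

record SquareAt (w : Word) (s p : ℕ) : Set where
  constructor square-at
  field
    period-pos : 1 ≤ p
    fits       : s + p + p ≤ length w
    repeats    : ∀ q → q < p → w ! (s + q) ≡ w ! (s + p + q)

square-at′ : ∀ {w i j} → 1 ≤ j → i + j + j ≤ length w → (∀ q → q < j → w ! (i + q) ≡ w ! (i + q + j)) → SquareAt w i j
square-at′ {w} {i} {j} j≥1 fits letters = square-at j≥1 fits λ q q<j → letters q q<j ⟨ trans ⟩ cong (w !_) (swap i q j)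
  where
  swap : ∀ i q j → i + q + j ≡ i + j + q
  swap = solve-∀

module _ {w : Word} where

  SquareAt-drop⁺ : ∀ k {s p} → SquareAt w (k + s) p → SquareAt (drop k w) s p
  SquareAt-drop⁺ k {s} {p} (square-at p≥1 fits repeats) = square-at p≥1 fits′ repeats′
    where
    fits′ : s + p + p ≤ length (drop k w)
    fits′ = subst (s + p + p ≤_) (sym (length-drop k w))
              (m+n≤o⇒m≤o∸n (s + p + p) (subst (_≤ length w) (shuffle k s p) fits))
      where
      shuffle : ∀ k s p → k + s + p + p ≡ s + p + p + k
      shuffle = solve-∀
    repeats′ : ∀ q → q < p → drop k w ! (s + q) ≡ drop k w ! (s + p + q)
    repeats′ q q<p = begin
      drop k w ! (s + q)         ≡⟨ at-drop a k w (s + q) ⟩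
      w ! (k + (s + q))          ≡⟨ cong (w !_) (+-assoc k s q) ⟨
      w ! (k + s + q)            ≡⟨ repeats q q<p ⟩
      w ! (k + s + p + q)        ≡⟨ cong (λ i → w ! (i + q)) (+-assoc k s p) ⟩
      w ! (k + (s + p) + q)      ≡⟨ cong (w !_) (+-assoc k (s + p) q) ⟩
      w ! (k + (s + p + q))      ≡⟨ at-drop a k w (s + p + q) ⟨
      drop k w ! (s + p + q)     ∎
      where open ≡-Reasoning

  SquareAt-drop⁻ : ∀ k {s p} → SquareAt (drop k w) s p → SquareAt w (k + s) p
  SquareAt-drop⁻ k {s} {p} (square-at p≥1 fits repeats) = square-at p≥1 fits′ repeats′
    where
    k≤∣w∣ : k ≤ length w
    k≤∣w∣ = <⇒≤ (m∸n≢0⇒n<m {length w} {k} λ eq →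
      contradiction (≤-trans (≤-trans p≥1 (m≤n+m p (s + p))) (subst (s + p + p ≤_) (length-drop k w ⟨ trans ⟩ eq) fits)) λ ())
    fits′ : k + s + p + p ≤ length w
    fits′ = subst (_≤ length w) (shuffle k s p)
              (m≤o∸n⇒m+n≤o (s + p + p) k≤∣w∣ (subst (s + p + p ≤_) (length-drop k w) fits))
      where
      shuffle : ∀ k s p → s + p + p + k ≡ k + s + p + p
      shuffle = solve-∀
    repeats′ : ∀ q → q < p → w ! (k + s + q) ≡ w ! (k + s + p + q)
    repeats′ q q<p = begin
      w ! (k + s + q)            ≡⟨ cong (w !_) (+-assoc k s q) ⟩
      w ! (k + (s + q))          ≡⟨ at-drop a k w (s + q) ⟨
      drop k w ! (s + q)         ≡⟨ repeats q q<p ⟩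
      drop k w ! (s + p + q)     ≡⟨ at-drop a k w (s + p + q) ⟩
      w ! (k + (s + p + q))      ≡⟨ cong (w !_) (+-assoc k (s + p) q) ⟨
      w ! (k + (s + p) + q)      ≡⟨ cong (λ i → w ! (i + q)) (+-assoc k s p) ⟨
      w ! (k + s + p + q)        ∎
      where open ≡-Reasoning

  SquareAt-take : ∀ k {s p} → s + p + p ≤ k → SquareAt w s p → SquareAt (take k w) s p
  SquareAt-take k {s} {p} ≤k (square-at p≥1 fits repeats) =
    square-at p≥1 (subst (s + p + p ≤_) (sym (length-take k w)) (⊓-glb ≤k fits)) repeats′
    where
    repeats′ : ∀ q → q < p → take k w ! (s + q) ≡ take k w ! (s + p + q)
    repeats′ q q<p = begin
      take k w ! (s + q)       ≡⟨ at-take a k w (<-≤-trans (+-monoʳ-< s q<p) (≤-trans (m≤m+n (s + p) p) ≤k)) ⟩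
      w ! (s + q)              ≡⟨ repeats q q<p ⟩
      w ! (s + p + q)          ≡⟨ at-take a k w (<-≤-trans (+-monoʳ-< (s + p) q<p) ≤k) ⟨
      take k w ! (s + p + q)   ∎
      where open ≡-Reasoning

SquareAt-zero⇒CommonPrefix : ∀ {w p} → SquareAt w 0 p → CommonPrefix p w (drop p w)
SquareAt-zero⇒CommonPrefix {w} {p} (square-at _ fits repeats) =
  common-prefix (≤-trans (m≤m+n p p) fits)
                (subst (p ≤_) (sym (length-drop p w)) (m+n≤o⇒m≤o∸n p fits))
                λ j j<p → repeats j j<p ⟨ trans ⟩ sym (at-drop a p w j)

CommonPrefix⇒SquareAt-zero : ∀ {w p} → 1 ≤ p → CommonPrefix p w (drop p w) → SquareAt w 0 p
CommonPrefix⇒SquareAt-zero {w} {p} p≥1 (common-prefix p≤w p≤rest agree) =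
  square-at p≥1 (m≤o∸n⇒m+n≤o p p≤w (subst (p ≤_) (length-drop p w) p≤rest))
            λ q q<p → agree q q<p ⟨ trans ⟩ at-drop a p w q

SquareAt-zero⇒HasSquare : ∀ {w p} → SquareAt w 0 p → HasSquare w
SquareAt-zero⇒HasSquare {w} {p} sq = [] , y , drop p (drop p w) , y≢[] , split
  where
  cp : CommonPrefix p w (drop p w)
  cp = SquareAt-zero⇒CommonPrefix sq
  y : Word
  y = take p w
  y≢[] : y ≢ []
  y≢[] y≡[] = contradiction (subst (1 ≤_) p≡0 (SquareAt.period-pos sq)) λ ()
    where
    p≡0 : p ≡ 0
    p≡0 = sym (length-take-≤ p w (CommonPrefix.≤-lengthˡ cp)) ⟨ trans ⟩ cong length y≡[]
  split : w ≡ y ++ (y ++ drop p (drop p w))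
  split = begin
    w                                                ≡⟨ take++drop≡id p w ⟨
    y ++ drop p w                                    ≡⟨ cong (y ++_) (take++drop≡id p (drop p w)) ⟨
    y ++ (take p (drop p w) ++ drop p (drop p w))    ≡⟨ cong (λ z → y ++ (z ++ drop p (drop p w))) (CommonPrefix⇒take≡take cp) ⟨
    y ++ (y ++ drop p (drop p w))                    ∎
    where open ≡-Reasoning

HasSquare-++ˡ : ∀ {u} v → HasSquare u → HasSquare (u ++ v)
HasSquare-++ˡ v (l , y , r , y≢[] , refl) =
  l , y , r ++ v , y≢[] , trans (++-assoc l _ v) (cong (l ++_) (trans (++-assoc y _ v) (cong (y ++_) (++-assoc y r v))))

HasSquare-++ʳ : ∀ u {v} → HasSquare v → HasSquare (u ++ v)
HasSquare-++ʳ u (l , y , r , y≢[] , refl) = u ++ l , y , r , y≢[] , sym (++-assoc u l _)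

HasSquare⇔SquareAt : ∀ {w} → HasSquare w ⇔ (∃[ s ] ∃[ p ] SquareAt w s p)
HasSquare⇔SquareAt {w} = mk⇔ to from
  where
  to : HasSquare w → ∃[ s ] ∃[ p ] SquareAt w s p
  to (u , y , v , y≢[] , refl) = length u + 0 , length y , SquareAt-drop⁻ (length u) sq
    where
    sq : SquareAt (drop (length u) (u ++ (y ++ (y ++ v)))) 0 (length y)
    sq rewrite drop-++ u (y ++ (y ++ v)) =
      CommonPrefix⇒SquareAt-zero (nonempty y y≢[])
        (subst (CommonPrefix (length y) (y ++ (y ++ v))) (sym (drop-++ y (y ++ v))) (CommonPrefix-++ y (y ++ v) v))
      where
      nonempty : ∀ (y : Word) → y ≢ [] → 1 ≤ length y
      nonempty []      y≢[] = contradiction refl y≢[]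
      nonempty (_ ∷ _) _    = s≤s z≤n
  from : ∃[ s ] ∃[ p ] SquareAt w s p → HasSquare w
  from (s , p , sq) = subst HasSquare (take++drop≡id s w)
    (HasSquare-++ʳ (take s w) (SquareAt-zero⇒HasSquare (SquareAt-drop⁺ s (subst (λ i → SquareAt w i p) (sym (+-identityʳ s)) sq))))

SquareFree-take : ∀ k {w} → SquareFree w → SquareFree (take k w)
SquareFree-take k {w} sf sq = sf (subst HasSquare (take++drop≡id k w) (HasSquare-++ˡ (drop k w) sq))

SquareFree-drop : ∀ k {w} → SquareFree w → SquareFree (drop k w)
SquareFree-drop k {w} sf sq = sf (subst HasSquare (take++drop≡id k w) (HasSquare-++ʳ (take k w) sq))

single-letter-squareFree : ∀ x → SquareFree (x ∷ [])
single-letter-squareFree x sq with Equivalence.to HasSquare⇔SquareAt sq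
... | s , p , square-at p≥1 fits _ = contradiction (≤-trans (+-mono-≤ (≤-trans p≥1 (m≤n+m p s)) p≥1) fits) λ { (s≤s ()) }

-- Morphisms with two images per letter

ChoiceMorphism : Set
ChoiceMorphism = Letter → Bool → Word

image : ChoiceMorphism → Word → (ℕ → Bool) → Word
image φ []       c = []
image φ (x ∷ xs) c = φ x (c 0) ++ image φ xs (c ∘ suc)

image-cong : ∀ φ xs {c c′} → (∀ l → l < length xs → c l ≡ c′ l) → image φ xs c ≡ image φ xs c′
image-cong φ []       eq = refl
image-cong φ (x ∷ xs) eq = cong₂ _++_ (cong (φ x) (eq 0 (s≤s z≤n))) (image-cong φ xs λ l l< → eq (suc l) (s≤s l<))

module Uniform (φ : ChoiceMorphism) (L : ℕ) (uniform : ∀ x e → length (φ x e) ≡ L) where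

  length-image : ∀ xs c → length (image φ xs c) ≡ length xs * L
  length-image []       c = refl
  length-image (x ∷ xs) c = length-++ (φ x (c 0)) ⟨ trans ⟩ cong₂ _+_ (uniform x (c 0)) (length-image xs (c ∘ suc))

  shift-by-block : ∀ x e k → L + k ≡ length (φ x e) + k
  shift-by-block x e k = cong (_+ k) (sym (uniform x e))

  drop-past-block : ∀ x e k (w : Word) → drop (L + k) (φ x e ++ w) ≡ drop k w
  drop-past-block x e k w = cong (λ i → drop i (φ x e ++ w)) (shift-by-block x e k) ⟨ trans ⟩ drop-++ˡ (φ x e) w k

  drop-image : ∀ k xs c → drop (k * L) (image φ xs c) ≡ image φ (drop k xs) (λ l → c (k + l))
  drop-image zero    xs       c = refl
  drop-image (suc k) []       c = drop-[] (suc k * L)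
  drop-image (suc k) (x ∷ xs) c =
    drop-past-block x (c 0) (k * L) _ ⟨ trans ⟩ drop-image k xs (c ∘ suc)

  take-image : ∀ k xs c → take (k * L) (image φ xs c) ≡ image φ (take k xs) c
  take-image zero    xs       c = refl
  take-image (suc k) []       c = take-[] (suc k * L)
  take-image (suc k) (x ∷ xs) c =
    cong (λ i → take i (image φ (x ∷ xs) c)) (shift-by-block x (c 0) (k * L))
      ⟨ trans ⟩ take-++ˡ (φ x (c 0)) _ (k * L) ⟨ trans ⟩ cong (φ x (c 0) ++_) (take-image k xs (c ∘ suc))

  take-image-partial : ∀ i xs c {r} → i < length xs → r ≤ L →
                       take (i * L + r) (image φ xs c) ≡ image φ (take i xs) c ++ take r (φ (xs ! i) (c i))
  take-image-partial zero    (x ∷ xs) c _ r≤L = take-++ʳ (φ x (c 0)) _ (subst (_ ≤_) (sym (uniform x (c 0))) r≤L)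
  take-image-partial (suc i) (x ∷ xs) c {r} (s≤s i<) r≤L = begin
    take (L + i * L + r) (φ x (c 0) ++ image φ xs (c ∘ suc))
      ≡⟨ cong (λ k → take k (φ x (c 0) ++ image φ xs (c ∘ suc)))
              (+-assoc L (i * L) r ⟨ trans ⟩ shift-by-block x (c 0) (i * L + r)) ⟩
    take (length (φ x (c 0)) + (i * L + r)) (φ x (c 0) ++ image φ xs (c ∘ suc))
      ≡⟨ take-++ˡ (φ x (c 0)) _ (i * L + r) ⟩
    φ x (c 0) ++ take (i * L + r) (image φ xs (c ∘ suc))
      ≡⟨ cong (φ x (c 0) ++_) (take-image-partial i xs (c ∘ suc) i< r≤L) ⟩
    φ x (c 0) ++ (image φ (take i xs) (c ∘ suc) ++ take r (φ (xs ! i) (c (suc i))))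
      ≡⟨ ++-assoc (φ x (c 0)) _ _ ⟨
    (φ x (c 0) ++ image φ (take i xs) (c ∘ suc)) ++ take r (φ (xs ! i) (c (suc i)))  ∎
    where open ≡-Reasoning

  image-! : ∀ l xs c {u} → l < length xs → u < L → image φ xs c ! (l * L + u) ≡ φ (xs ! l) (c l) ! u
  image-! zero    (x ∷ xs) c _ u<L = at-++ˡ a (φ x (c 0)) _ (subst (_ <_) (sym (uniform x (c 0))) u<L)
  image-! (suc l) (x ∷ xs) c {u} (s≤s l<) u<L = begin
    (φ x (c 0) ++ image φ xs (c ∘ suc)) ! (L + l * L + u)
      ≡⟨ cong ((φ x (c 0) ++ image φ xs (c ∘ suc)) !_) (+-assoc L (l * L) u ⟨ trans ⟩ shift-by-block x (c 0) (l * L + u)) ⟩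
    (φ x (c 0) ++ image φ xs (c ∘ suc)) ! (length (φ x (c 0)) + (l * L + u))
      ≡⟨ at-++ʳ a (φ x (c 0)) _ (l * L + u) ⟩
    image φ xs (c ∘ suc) ! (l * L + u)
      ≡⟨ image-! l xs (c ∘ suc) l< u<L ⟩
    φ (xs ! l) (c (suc l)) ! u  ∎
    where open ≡-Reasoning

  drop-image-block : ∀ l xs c → l < length xs →
                     drop (l * L) (image φ xs c) ≡ φ (xs ! l) (c l) ++ drop (suc l * L) (image φ xs c)
  drop-image-block zero    (x ∷ xs) c _        = sym (cong (φ x (c 0) ++_) (drop-past-block x (c 0) 0 _))
  drop-image-block (suc l) (x ∷ xs) c (s≤s l<) =
    drop-past-block x (c 0) (l * L) _ ⟨ trans ⟩ drop-image-block l xs (c ∘ suc) l<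
      ⟨ trans ⟩ sym (cong (φ (xs ! l) (c (suc l)) ++_) (drop-past-block x (c 0) (suc l * L) _))

record SquareFreeCertificate (φ : ChoiceMorphism) (L : ℕ) : Set where
  field
    uniform           : ∀ x e → length (φ x e) ≡ L
    sync-length       : ℕ
    marker-length     : ℕ
    sync≤L            : sync-length ≤ L
    2sync≤L+5         : sync-length + sync-length ≤ L + 5
    marker≤L          : marker-length ≤ L
    2marker≤L+1       : marker-length + marker-length ≤ L + 1
    synchronizing     : ∀ {x y} e f z g {t} → x ≢ y → 1 ≤ t → t < L →
                        ¬ CommonPrefix sync-length (drop t (φ x e ++ φ y f)) (φ z g)
    prefix-determines : ∀ {x y} e f → CommonPrefix marker-length (φ x e) (φ y f) → x ≡ y
    suffix-determines : ∀ {x y} e f →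
                        CommonPrefix marker-length (drop (L ∸ marker-length) (φ x e)) (drop (L ∸ marker-length) (φ y f)) → x ≡ y
    short-images      : ∀ ys c → 1 ≤ length ys → length ys ≤ 4 → SquareFree ys →
                        ∀ {t p} → t < L → ¬ SquareAt (image φ ys c) t p

-- The square-freeness criterion

other : Letter → Letter
other zero    = suc zero
other (suc _) = zero

other-≢ : ∀ x → other x ≢ x
other-≢ zero    ()
other-≢ (suc _) ()

module _ (L : ℕ) .{{_ : NonZero L}} where

  block-coordinates : ∀ r → r ≡ r / L * L + r % L
  block-coordinates r = m≡m%n+[m/n]*n r L ⟨ trans ⟩ +-comm (r % L) (r / L * L)

  block-index-< : ∀ {i t r n} → r ≡ i * L + t → r < n * L → i < n
  block-index-< {i} {t} {r} {n} refl r< = *-cancelʳ-< _ i n (≤-<-trans (m≤m+n (i * L) t) r<)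

  next-boundary : ∀ s → ∃[ k ] ∃[ δ ] (k * L ≡ s + δ × δ < L)
  next-boundary s with s % L | block-coordinates s | m%n<n s L
  ... | zero  | s≡ | _   =
    s / L , 0 , (sym (s≡ ⟨ trans ⟩ +-identityʳ (s / L * L)) ⟨ trans ⟩ sym (+-identityʳ s)) , >-nonZero⁻¹ L
  ... | suc t | s≡ | t<L = suc (s / L) , L ∸ suc t , eq , ∸-monoʳ-< (s≤s z≤n) (<⇒≤ t<L)
    where
    eq : suc (s / L) * L ≡ s + (L ∸ suc t)
    eq = begin
      L + s / L * L                      ≡⟨ +-comm L (s / L * L) ⟩
      s / L * L + L                      ≡⟨ cong (s / L * L +_) (m+[n∸m]≡n (<⇒≤ t<L)) ⟨
      s / L * L + (suc t + (L ∸ suc t))  ≡⟨ +-assoc (s / L * L) (suc t) (L ∸ suc t) ⟨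
      s / L * L + suc t + (L ∸ suc t)    ≡⟨ cong (_+ (L ∸ suc t)) s≡ ⟨
      s + (L ∸ suc t)                    ∎
      where open ≡-Reasoning

  short-square-fits : ∀ {m t p} → t < L → suc (suc p) ≤ L + m → m + m ≤ L + 5 → t + p + p ≤ 4 * L
  short-square-fits {m} {t} {p} t<L short 2m≤ = +-cancelʳ-≤ 5 (t + p + p) (4 * L) (begin
    t + p + p + 5                      ≡⟨ shuffle t p ⟩
    suc t + suc (suc p) + suc (suc p)  ≤⟨ +-mono-≤ (+-mono-≤ t<L short) short ⟩
    L + (L + m) + (L + m)              ≡⟨ regroup L m ⟩
    3 * L + (m + m)                    ≤⟨ +-monoʳ-≤ (3 * L) 2m≤ ⟩
    3 * L + (L + 5)                    ≡⟨ finish L ⟩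
    4 * L + 5                          ∎)
    where
    open ≤-Reasoning
    shuffle : ∀ t p → t + p + p + 5 ≡ suc t + suc (suc p) + suc (suc p)
    shuffle = solve-∀
    regroup : ∀ L m → L + (L + m) + (L + m) ≡ 3 * L + (m + m)
    regroup = solve-∀
    finish : ∀ L → 3 * L + (L + 5) ≡ 4 * L + 5
    finish = solve-∀

  remaining-fits : ∀ {i t s n q} → s ≡ i * L + t → s + q ≤ n * L → t + q ≤ (n ∸ i) * L
  remaining-fits {i} {t} {s} {n} {q} refl fits =
    subst (t + q ≤_) (sym (*-distribʳ-∸ L n i))
      (m+n≤o⇒m≤o∸n (t + q) (subst (_≤ n * L) (shuffle (i * L) t q) fits))
    where
    shuffle : ∀ x t q → x + t + q ≡ t + q + x
    shuffle = solve-∀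

  n≤2L[n/L] : ∀ {n} → L < n → n ≤ 2 * L * (n / L)
  n≤2L[n/L] {n} L<n with n / L | block-coordinates n | m%n<n n L
  ... | zero  | n≡ | r<L = contradiction (subst (_< L) (sym n≡) r<L) (<⇒≯ L<n)
  ... | suc i | n≡ | _   = begin
    n                             ≡⟨ n≡ ⟩
    suc i * L + n % L             ≤⟨ +-monoʳ-≤ (suc i * L) (<⇒≤ (<-≤-trans (m%n<n n L) (m≤m+n L (i * L)))) ⟩
    suc i * L + suc i * L         ≡⟨ double (suc i) L ⟩
    2 * L * suc i                 ∎
    where
    open ≤-Reasoning
    double : ∀ i L → i * L + i * L ≡ 2 * L * i
    double = solve-∀

module SquareFreeness {φ : ChoiceMorphism} {L : ℕ} .{{_ : NonZero L}} (cert : SquareFreeCertificate φ L) where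
  open SquareFreeCertificate cert renaming (sync-length to m; marker-length to h)
  open Uniform φ L uniform

  module _ {xs : Word} (c : ℕ → Bool) (xs-sf : SquareFree xs) where
    private
      W : Word
      W = image φ xs c
      n : ℕ
      n = length xs
      block : ℕ → Word
      block l = φ (xs ! l) (c l)

      ∣W∣ : length W ≡ n * L
      ∣W∣ = length-image xs c

      square-in-xs : ∀ {i p} → SquareAt xs i p → ⊥
      square-in-xs {i} {p} sq = xs-sf (Equivalence.from HasSquare⇔SquareAt (i , p , sq))

    neighbours-differ : ∀ {l} → suc l < n → xs ! suc l ≢ xs ! l
    neighbours-differ {l} l+1<n eq = square-in-xs (square-at (s≤s z≤n) fits λ { zero _ → repeat ; (suc q) (s≤s ()) })
      where
      fits : l + 1 + 1 ≤ n
      fits = subst (_≤ n) (l+2≡ l) l+1<n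
        where
        l+2≡ : ∀ l → suc (suc l) ≡ l + 1 + 1
        l+2≡ = solve-∀
      repeat : xs ! (l + 0) ≡ xs ! (l + 1 + 0)
      repeat = cong (xs !_) (+-identityʳ l) ⟨ trans ⟩ sym eq
                 ⟨ trans ⟩ cong (xs !_) (sym (+-identityʳ (l + 1) ⟨ trans ⟩ +-comm l 1))

    -- Such a square lies in the images of at most four consecutive letters of xs.
    no-short-square : ∀ {s p} → SquareAt W s p → suc (suc p) ≤ L + m → ⊥
    no-short-square {s} {p} sq short =
      short-images window (λ l → c (i + l)) 1≤∣window∣ ∣window∣≤4 (SquareFree-take k (SquareFree-drop i xs-sf))
                   (m%n<n s L) sq-window
      where
      i : ℕ
      i = s / L
      t : ℕ
      t = s % L
      k : ℕ
      k = 4 ⊓ (n ∸ i)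
      window : Word
      window = take k (drop i xs)
      s≡ : s ≡ i * L + t
      s≡ = block-coordinates L s
      fits : s + p + p ≤ n * L
      fits = SquareAt.fits sq ⟨ ≤-trans ⟩ ≤-reflexive ∣W∣
      i<n : i < n
      i<n = block-index-< L s≡ (<-≤-trans (m<m+n s (SquareAt.period-pos sq)) (≤-trans (m≤m+n (s + p) p) fits))
      ∣window∣ : length window ≡ k
      ∣window∣ = length-take k (drop i xs) ⟨ trans ⟩ cong (k ⊓_) (length-drop i xs)
                   ⟨ trans ⟩ m≤n⇒m⊓n≡m (m⊓n≤n 4 (n ∸ i))
      1≤∣window∣ : 1 ≤ length window
      1≤∣window∣ = subst (1 ≤_) (sym ∣window∣) (⊓-glb (s≤s z≤n) (m<n⇒0<n∸m i<n))
      ∣window∣≤4 : length window ≤ 4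
      ∣window∣≤4 = subst (_≤ 4) (sym ∣window∣) (m⊓n≤m 4 (n ∸ i))
      t+2p≤kL : t + p + p ≤ k * L
      t+2p≤kL = subst (t + p + p ≤_) (sym (*-distribʳ-⊓ L 4 (n ∸ i)))
                  (⊓-glb (short-square-fits L (m%n<n s L) short 2sync≤L+5)
                         (subst (_≤ (n ∸ i) * L) (sym (+-assoc t p p))
                           (remaining-fits L {i} {t} {s} {n} {p + p} s≡ (subst (_≤ n * L) (+-assoc s p p) fits))))
      window-image : take (k * L) (drop (i * L) W) ≡ image φ window (λ l → c (i + l))
      window-image = cong (take (k * L)) (drop-image i xs c) ⟨ trans ⟩ take-image k (drop i xs) _
      sq-window : SquareAt (image φ window (λ l → c (i + l))) t p
      sq-window = subst (λ w → SquareAt w t p) window-image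
                    (SquareAt-take (k * L) t+2p≤kL (SquareAt-drop⁺ (i * L) (subst (λ s → SquareAt W s p) s≡ sq)))

    -- A factor starting inside block l and not longer than a block lies in block l followed by a block of a
    -- different letter; past the end of W that block is chosen freely.
    next-block-window : ∀ {l t k} v → l < n → 1 ≤ t → t < L → k ≤ L → CommonPrefix k (drop t (drop (l * L) W)) v →
                        ∃[ y ] ∃[ f ] (y ≢ xs ! l × CommonPrefix k (drop t (block l ++ φ y f)) v)
    next-block-window {l} {t} {k} v l<n _ t<L k≤L cp with suc l <? n
    ... | yes l+1<n = xs ! suc l , c (suc l) , neighbours-differ l+1<n ,
          CommonPrefix-++⁻ rest′ k≤ (subst (λ w → CommonPrefix k w v) split cp)
      where
      rest′ : Word
      rest′ = drop (suc (suc l) * L) W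
      two-blocks : Word
      two-blocks = block l ++ block (suc l)
      ∣two-blocks∣ : length two-blocks ≡ L + L
      ∣two-blocks∣ = length-++ (block l) ⟨ trans ⟩ cong₂ _+_ (uniform _ _) (uniform _ _)
      split : drop t (drop (l * L) W) ≡ drop t two-blocks ++ rest′
      split = begin
        drop t (drop (l * L) W)                       ≡⟨ cong (drop t) (drop-image-block l xs c l<n) ⟩
        drop t (block l ++ drop (suc l * L) W)        ≡⟨ cong (λ w → drop t (block l ++ w)) (drop-image-block (suc l) xs c l+1<n) ⟩
        drop t (block l ++ (block (suc l) ++ rest′))  ≡⟨ cong (drop t) (++-assoc (block l) _ rest′) ⟨
        drop t (two-blocks ++ rest′)                  ≡⟨ drop-++ʳ two-blocks rest′ t≤ ⟩
        drop t two-blocks ++ rest′                    ∎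
        where
        open ≡-Reasoning
        t≤ : t ≤ length two-blocks
        t≤ = subst (t ≤_) (sym ∣two-blocks∣) (≤-trans (<⇒≤ t<L) (m≤m+n L L))
      k≤ : k ≤ length (drop t two-blocks)
      k≤ = subst (k ≤_) (sym (length-drop t two-blocks ⟨ trans ⟩ cong (_∸ t) ∣two-blocks∣))
             (≤-trans k≤L (≤-trans (m≤m+n L (L ∸ t)) (≤-reflexive (sym (+-∸-assoc L (<⇒≤ t<L))))))
    ... | no l+1≮n = other (xs ! l) , false , other-≢ (xs ! l) ,
          subst (λ w → CommonPrefix k w v) (sym (drop-++ʳ (block l) _ t≤L)) (CommonPrefix-++⁺ (φ (other (xs ! l)) false) cp′)
      where
      t≤L : t ≤ length (block l)
      t≤L = subst (t ≤_) (sym (uniform _ _)) (<⇒≤ t<L)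
      last-block : drop (l * L) W ≡ block l
      last-block = drop-image-block l xs c l<n ⟨ trans ⟩ cong (block l ++_) (drop-all (suc l * L) W ∣W∣≤)
                     ⟨ trans ⟩ ++-identityʳ (block l)
        where
        ∣W∣≤ : length W ≤ suc l * L
        ∣W∣≤ = subst (_≤ suc l * L) (sym ∣W∣) (*-monoˡ-≤ L (≮⇒≥ l+1≮n))
      cp′ : CommonPrefix k (drop t (block l)) v
      cp′ = subst (λ w → CommonPrefix k (drop t w) v) last-block cp

    block-prefix-aligned : ∀ {r} z g → r + m ≤ n * L → CommonPrefix m (drop r W) (φ z g) → r % L ≡ 0
    block-prefix-aligned {r} z g fits cp with r % L | block-coordinates L r | m%n<n r L
    ... | zero  | _  | _   = refl
    ... | suc t | r≡ | t<L =
      let y , f , y≢ , cp′ = next-block-window (φ z g) i<n (s≤s z≤n) t<L sync≤L cp-in-block in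
      ⊥-elim (synchronizing (c i) f z g (y≢ ∘ sym) (s≤s z≤n) t<L cp′)
      where
      i : ℕ
      i = r / L
      i<n : i < n
      i<n = *-cancelʳ-< _ i n (<-≤-trans (m<m+n (i * L) (s≤s z≤n)) (≤-trans (≤-reflexive (sym r≡)) (≤-trans (m≤m+n r m) fits)))
      cp-in-block : CommonPrefix m (drop (suc t) (drop (i * L) W)) (φ z g)
      cp-in-block = subst (λ w → CommonPrefix m w (φ z g)) (cong (λ r → drop r W) r≡ ⟨ trans ⟩ sym (drop-drop (i * L) (suc t) W)) cp

    -- The first block starting inside the first half of a long square reappears one period later.
    long-square-aligned : ∀ {s p} → SquareAt W s p → L + m ≤ suc p → p % L ≡ 0
    long-square-aligned {s} {p} (square-at p≥1 fits repeats) long with next-boundary L s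
    ... | k , δ , kL≡ , δ<L =
      sym ([m+kn]%n≡m%n p k L) ⟨ trans ⟩ cong (_% L) (+-comm p (k * L))
        ⟨ trans ⟩ block-prefix-aligned (xs ! k) (c k) kL+p+m≤ repeated
      where
      fits-W : s + p + p ≤ n * L
      fits-W = fits ⟨ ≤-trans ⟩ ≤-reflexive ∣W∣
      δ+m≤p : δ + m ≤ p
      δ+m≤p = s≤s⁻¹ (≤-trans (+-monoˡ-< m δ<L) long)
      kL+p+m≤ : k * L + p + m ≤ n * L
      kL+p+m≤ = begin
        k * L + p + m        ≡⟨ cong (λ x → x + p + m) kL≡ ⟩
        s + δ + p + m        ≡⟨ shuffle s δ p m ⟩
        s + p + (δ + m)      ≤⟨ +-monoʳ-≤ (s + p) δ+m≤p ⟩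
        s + p + p            ≤⟨ fits-W ⟩
        n * L                ∎
        where
        open ≤-Reasoning
        shuffle : ∀ s δ p m → s + δ + p + m ≡ s + p + (δ + m)
        shuffle = solve-∀
      k<n : k < n
      k<n = *-cancelʳ-< _ k n (begin-strict
        k * L          ≡⟨ kL≡ ⟩
        s + δ          ≤⟨ +-monoʳ-≤ s (≤-trans (m≤m+n δ m) δ+m≤p) ⟩
        s + p          <⟨ m<m+n (s + p) p≥1 ⟩
        s + p + p      ≤⟨ fits-W ⟩
        n * L          ∎)
        where open ≤-Reasoning
      block-start : CommonPrefix m (drop (k * L) W) (block k)
      block-start = subst (λ w → CommonPrefix m w (block k)) (sym (drop-image-block k xs c k<n))
                      (CommonPrefix-++⁺ _ (CommonPrefix-refl (subst (m ≤_) (sym (uniform _ _)) sync≤L)))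
      repeated : CommonPrefix m (drop (k * L + p) W) (block k)
      repeated = common-prefix m≤rest (CommonPrefix.≤-lengthʳ block-start) λ j j<m → begin
        drop (k * L + p) W ! j    ≡⟨ at-drop a (k * L + p) W j ⟩
        W ! (k * L + p + j)       ≡⟨ cong (λ x → W ! (x + p + j)) kL≡ ⟩
        W ! (s + δ + p + j)       ≡⟨ cong (W !_) (shuffle s δ p j) ⟩
        W ! (s + p + (δ + j))     ≡⟨ repeats (δ + j) (<-≤-trans (+-monoʳ-< δ j<m) δ+m≤p) ⟨
        W ! (s + (δ + j))         ≡⟨ cong (W !_) (cong (_+ j) kL≡ ⟨ trans ⟩ +-assoc s δ j) ⟨
        W ! (k * L + j)           ≡⟨ at-drop a (k * L) W j ⟨
        drop (k * L) W ! j        ≡⟨ CommonPrefix.agree block-start j j<m ⟩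
        block k ! j               ∎
        where
        open ≡-Reasoning
        shuffle : ∀ s δ p j → s + δ + p + j ≡ s + p + (δ + j)
        shuffle = solve-∀
        m≤rest : m ≤ length (drop (k * L + p) W)
        m≤rest = subst (m ≤_) (sym (length-drop (k * L + p) W))
                   (m+n≤o⇒m≤o∸n m (subst₂ _≤_ (+-comm (k * L + p) m) (sym ∣W∣) kL+p+m≤))

    -- A square of period j blocks forces xs ! l ≡ xs ! (l + j) for every block l that the first half covers
    -- far enough to read a marker; according to where the square starts in its block, these letters form a
    -- square of period j starting at block s / L or at the next one.
    module AlignedSquare {s j : ℕ} (sq : SquareAt W s (j * L)) where
      open SquareAt sq

      i : ℕ
      i = s / L
      t : ℕ
      t = s % L

      s≡ : s ≡ i * L + t
      s≡ = block-coordinates L s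

      fits-W : s + j * L + j * L ≤ n * L
      fits-W = fits ⟨ ≤-trans ⟩ ≤-reflexive ∣W∣

      shifted : ∀ r → s ≤ r → r < s + j * L → W ! r ≡ W ! (r + j * L)
      shifted r s≤r r< = begin
        W ! r                      ≡⟨ cong (W !_) (m+[n∸m]≡n s≤r) ⟨
        W ! (s + q)                ≡⟨ repeats q (+-cancelˡ-< s q (j * L) (subst (_< s + j * L) (sym (m+[n∸m]≡n s≤r)) r<)) ⟩
        W ! (s + j * L + q)        ≡⟨ cong (W !_) (swap s (j * L) q ⟨ trans ⟩ cong (_+ j * L) (m+[n∸m]≡n s≤r)) ⟩
        W ! (r + j * L)            ∎
        where
        open ≡-Reasoning
        q : ℕ
        q = r ∸ s
        swap : ∀ s p q → s + p + q ≡ s + q + p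
        swap = solve-∀

      regroup : ∀ l u → (l + j) * L + u ≡ l * L + u + j * L
      regroup l u = lemma l j u L
        where
        lemma : ∀ l j u L → (l + j) * L + u ≡ l * L + u + j * L
        lemma = solve-∀

      shifted-block-< : ∀ l u → l * L + u < s + j * L → l + j < n
      shifted-block-< l u hi = block-index-< L refl (begin-strict
        (l + j) * L + u          ≡⟨ regroup l u ⟩
        l * L + u + j * L        <⟨ +-monoˡ-< (j * L) hi ⟩
        s + j * L + j * L        ≤⟨ fits-W ⟩
        n * L                    ∎)
        where open ≤-Reasoning

      blocks-agree : ∀ l u → u < L → s ≤ l * L + u → l * L + u < s + j * L → block l ! u ≡ block (l + j) ! u
      blocks-agree l u u<L lo hi = begin
        block l ! u                ≡⟨ image-! l xs c (≤-<-trans (m≤m+n l j) l+j<n) u<L ⟨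
        W ! (l * L + u)            ≡⟨ shifted (l * L + u) lo hi ⟩
        W ! (l * L + u + j * L)    ≡⟨ cong (W !_) (regroup l u) ⟨
        W ! ((l + j) * L + u)      ≡⟨ image-! (l + j) xs c l+j<n u<L ⟩
        block (l + j) ! u          ∎
        where
        open ≡-Reasoning
        l+j<n : l + j < n
        l+j<n = shifted-block-< l u hi

      h≤block : ∀ l → h ≤ length (block l)
      h≤block l = subst (h ≤_) (sym (uniform _ _)) marker≤L

      prefix-letters : ∀ l → s ≤ l * L → l * L + h ≤ s + j * L → xs ! l ≡ xs ! (l + j)
      prefix-letters l lo hi = prefix-determines (c l) (c (l + j)) (common-prefix (h≤block l) (h≤block (l + j)) λ u u<h →
        blocks-agree l u (<-≤-trans u<h marker≤L) (≤-trans lo (m≤m+n (l * L) u)) (<-≤-trans (+-monoʳ-< (l * L) u<h) hi))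

      suffix-letters : ∀ l → s ≤ l * L + (L ∸ h) → l * L + L ≤ s + j * L → xs ! l ≡ xs ! (l + j)
      suffix-letters l lo hi = suffix-determines (c l) (c (l + j)) (common-prefix (h≤suffix l) (h≤suffix (l + j)) λ u u<h →
        at-drop a (L ∸ h) (block l) u
          ⟨ trans ⟩ blocks-agree l (L ∸ h + u) (offset< u<h) (≤-trans lo (≤-reflexive-+ u))
                                 (<-≤-trans (+-monoʳ-< (l * L) (offset< u<h)) hi)
          ⟨ trans ⟩ sym (at-drop a (L ∸ h) (block (l + j)) u))
        where
        h≤suffix : ∀ l → h ≤ length (drop (L ∸ h) (block l))
        h≤suffix l = ≤-reflexive (sym (length-drop (L ∸ h) (block l)
                       ⟨ trans ⟩ cong (_∸ (L ∸ h)) (uniform _ _) ⟨ trans ⟩ m∸[m∸n]≡n marker≤L))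
        offset< : ∀ {u} → u < h → L ∸ h + u < L
        offset< {u} u<h = <-≤-trans (+-monoʳ-< (L ∸ h) u<h) (≤-reflexive (m∸n+n≡m marker≤L))
        ≤-reflexive-+ : ∀ u → l * L + (L ∸ h) ≤ l * L + (L ∸ h + u)
        ≤-reflexive-+ u = ≤-trans (m≤m+n (l * L + (L ∸ h)) u) (≤-reflexive (+-assoc (l * L) (L ∸ h) u))

      j≥1 : 1 ≤ j
      j≥1 = n≢0⇒n>0 λ j≡0 → contradiction (subst (λ j → 1 ≤ j * L) j≡0 period-pos) λ ()

      starts-before : ∀ q → t ≤ q * L → s ≤ (i + q) * L
      starts-before q t≤ = ≤-trans (≤-reflexive s≡) (≤-trans (+-monoʳ-≤ (i * L) t≤) (≤-reflexive (sym (*-distribʳ-+ L i q))))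

      marker-covered : ∀ q → q < j → (i + q) * L + h ≤ s + j * L
      marker-covered q q<j = begin
        (i + q) * L + h       ≤⟨ +-monoʳ-≤ ((i + q) * L) marker≤L ⟩
        (i + q) * L + L       ≡⟨ cong (_+ L) (*-distribʳ-+ L i q) ⟩
        i * L + q * L + L     ≡⟨ +-assoc (i * L) (q * L) L ⟩
        i * L + (q * L + L)   ≡⟨ cong (i * L +_) (+-comm (q * L) L) ⟩
        i * L + suc q * L     ≤⟨ +-monoʳ-≤ (i * L) (*-monoˡ-≤ L q<j) ⟩
        i * L + j * L         ≤⟨ +-monoˡ-≤ (j * L) (m≤m+n (i * L) t) ⟩
        i * L + t + j * L     ≡⟨ cong (_+ j * L) s≡ ⟨
        s + j * L             ∎
        where open ≤-Reasoning

      interior : ∀ q → t ≤ q * L → q < j → xs ! (i + q) ≡ xs ! (i + q + j)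
      interior q t≤ q<j = prefix-letters (i + q) (starts-before q t≤) (marker-covered q q<j)

      t≤L*q : ∀ q → 1 ≤ q → t ≤ q * L
      t≤L*q q q≥1 = ≤-trans (<⇒≤ (m%n<n s L)) (≤-trans (≤-reflexive (sym (*-identityˡ L))) (*-monoˡ-≤ L q≥1))

      fits-blocks : (i + j + j) * L + t ≤ n * L
      fits-blocks = subst (_≤ n * L) (cong (λ s → s + j * L + j * L) s≡ ⟨ trans ⟩ regroup′ i j t L) fits-W
        where
        regroup′ : ∀ i j t L → i * L + t + j * L + j * L ≡ (i + j + j) * L + t
        regroup′ = solve-∀

      L≤jL : L ≤ j * L
      L≤jL = ≤-trans (≤-reflexive (sym (*-identityˡ L))) (*-monoˡ-≤ L j≥1)

      s+jL≡ : i * L + t + j * L ≡ s + j * L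
      s+jL≡ = cong (_+ j * L) (sym s≡)

      fits-unaligned : t ≢ 0 → i + j + j < n
      fits-unaligned t≢0 = *-cancelʳ-< _ (i + j + j) n (<-≤-trans (m<m+n _ (n≢0⇒n>0 t≢0)) fits-blocks)

      square-when-block-aligned : t ≡ 0 → SquareAt xs i j
      square-when-block-aligned t≡0 = square-at′ j≥1 fits-aligned λ q q<j → interior q (subst (_≤ q * L) (sym t≡0) z≤n) q<j
        where
        fits-aligned : i + j + j ≤ n
        fits-aligned = *-cancelʳ-≤ (i + j + j) n L (≤-trans (m≤m+n _ t) fits-blocks)

      square-when-suffix-covered : t ≢ 0 → t + h ≤ L → SquareAt xs i j
      square-when-suffix-covered t≢0 t+h≤L = square-at′ j≥1 (<⇒≤ (fits-unaligned t≢0)) λ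
        { zero    _   → cong (xs !_) (+-identityʳ i) ⟨ trans ⟩ first ⟨ trans ⟩ cong (λ k → xs ! (k + j)) (sym (+-identityʳ i))
        ; (suc q) q<j → interior (suc q) (t≤L*q (suc q) (s≤s z≤n)) q<j }
        where
        first : xs ! i ≡ xs ! (i + j)
        first = suffix-letters i
          (≤-trans (≤-reflexive s≡) (+-monoʳ-≤ (i * L) (m+n≤o⇒m≤o∸n t t+h≤L)))
          (≤-trans (+-monoʳ-≤ (i * L) L≤jL) (≤-trans (+-monoˡ-≤ (j * L) (m≤m+n (i * L) t)) (≤-reflexive s+jL≡)))

      square-when-prefix-covered : t ≢ 0 → L < t + h → SquareAt xs (suc i) j
      square-when-prefix-covered t≢0 L<t+h = square-at′ j≥1 (fits-unaligned t≢0) letters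
        where
        h≤t : h ≤ t
        h≤t = +-cancelʳ-≤ h h t (≤-trans 2marker≤L+1 (≤-trans (≤-reflexive (+-comm L 1)) L<t+h))
        last : xs ! (i + j) ≡ xs ! (i + j + j)
        last = prefix-letters (i + j) (starts-before j (t≤L*q j j≥1)) (begin
          (i + j) * L + h       ≡⟨ cong (_+ h) (*-distribʳ-+ L i j) ⟩
          i * L + j * L + h     ≤⟨ +-monoʳ-≤ (i * L + j * L) h≤t ⟩
          i * L + j * L + t     ≡⟨ swap (i * L) (j * L) t ⟩
          i * L + t + j * L     ≡⟨ s+jL≡ ⟩
          s + j * L             ∎)
          where
          open ≤-Reasoning
          swap : ∀ x y t → x + y + t ≡ x + t + y
          swap = solve-∀
        letters : ∀ q → q < j → xs ! (suc i + q) ≡ xs ! (suc i + q + j)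
        letters q q<j with suc q <? j
        ... | yes q+1<j = cong (xs !_) (sym (+-suc i q)) ⟨ trans ⟩ interior (suc q) (t≤L*q (suc q) (s≤s z≤n)) q+1<j
                            ⟨ trans ⟩ cong (λ k → xs ! (k + j)) (+-suc i q)
        ... | no  q+1≮j = cong (xs !_) (sym (+-suc i q) ⟨ trans ⟩ cong (i +_) q+1≡j) ⟨ trans ⟩ last
                            ⟨ trans ⟩ cong (λ k → xs ! (k + j)) (sym (cong (i +_) q+1≡j) ⟨ trans ⟩ +-suc i q)
          where
          q+1≡j : suc q ≡ j
          q+1≡j = ≤-antisym q<j (≮⇒≥ q+1≮j)

    aligned-square-descends : ∀ {s p} → SquareAt W s p → p % L ≡ 0 → ⊥
    aligned-square-descends {s} {p} sq p%L≡0 = descend (t ≟ 0) (t + h ≤? L)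
      where
      p≡ : p ≡ p / L * L
      p≡ = block-coordinates L p ⟨ trans ⟩ cong (p / L * L +_) p%L≡0 ⟨ trans ⟩ +-identityʳ (p / L * L)
      open AlignedSquare {s} {p / L} (subst (SquareAt W s) p≡ sq)
      descend : Dec (t ≡ 0) → Dec (t + h ≤ L) → ⊥
      descend (yes t≡0)       _             = square-in-xs (square-when-block-aligned t≡0)
      descend (no t≢0)        (yes t+h≤L)   = square-in-xs (square-when-suffix-covered t≢0 t+h≤L)
      descend (no t≢0)        (no t+h≰L)    = square-in-xs (square-when-prefix-covered t≢0 (≰⇒> t+h≰L))

    image-squareFree : SquareFree (image φ xs c)
    image-squareFree sq with Equivalence.to HasSquare⇔SquareAt sq
    ... | s , p , sq-at with suc (suc p) ≤? L + m
    ...   | yes short = no-short-square sq-at short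
    ...   | no  long  = aligned-square-descends sq-at (long-square-aligned sq-at (s≤s⁻¹ (≰⇒> long)))

-- Checking the criterion by evaluation

T-∧⁻ : ∀ x {y} → T (x ∧ y) → T x × T y
T-∧⁻ _ = Equivalence.to T-∧

T-∧⁺ : ∀ {x y} → T x → T y → T (x ∧ y)
T-∧⁺ tx ty = Equivalence.from T-∧ (tx , ty)

T-not : ∀ {x} → T (not x) → ¬ T x
T-not {true} () _

T-not⁺ : ∀ {x} → ¬ T x → T (not x)
T-not⁺ {false} _  = _
T-not⁺ {true}  ¬t = ¬t _

T-∨-resolve : ∀ {x y} → T (x ∨ y) → ¬ T x → T y
T-∨-resolve {true}  _  ¬tx = ⊥-elim (¬tx _)
T-∨-resolve {false} ty _   = ty

-- By pattern matching rather than through Fin._≟_, which makes the certificates below much slower to check.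
_=ᴸ_ : Letter → Letter → Bool
zero             =ᴸ zero             = true
suc zero         =ᴸ suc zero         = true
suc (suc zero)   =ᴸ suc (suc zero)   = true
_                =ᴸ _                = false

=ᴸ⇒≡ : ∀ {x y} → T (x =ᴸ y) → x ≡ y
=ᴸ⇒≡ {zero} {zero} t = refl
=ᴸ⇒≡ {suc zero} {suc zero} t = refl
=ᴸ⇒≡ {suc (suc zero)} {suc (suc zero)} t = refl

≡⇒=ᴸ : ∀ {x y} → x ≡ y → T (x =ᴸ y)
≡⇒=ᴸ {zero} refl = _
≡⇒=ᴸ {suc zero} refl = _
≡⇒=ᴸ {suc (suc zero)} refl = _

∀ᴸ : (Letter → Bool) → Bool
∀ᴸ P = P zero ∧ P (suc zero) ∧ P (suc (suc zero))

∀ᴸ-sound : ∀ {P : Letter → Bool} → T (∀ᴸ P) → ∀ x → T (P x)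
∀ᴸ-sound {P} t zero             = proj₁ (T-∧⁻ (P zero) t)
∀ᴸ-sound {P} t (suc zero)       = proj₁ (T-∧⁻ (P (suc zero)) (proj₂ (T-∧⁻ (P zero) t)))
∀ᴸ-sound {P} t (suc (suc zero)) = proj₂ (T-∧⁻ (P (suc zero)) (proj₂ (T-∧⁻ (P zero) t)))

∀ᴮ : (Bool → Bool) → Bool
∀ᴮ P = P false ∧ P true

∀ᴮ-sound : ∀ {P : Bool → Bool} → T (∀ᴮ P) → ∀ e → T (P e)
∀ᴮ-sound {P} t false = proj₁ (T-∧⁻ (P false) t)
∀ᴮ-sound {P} t true  = proj₂ (T-∧⁻ (P false) t)

∀ᴸᴮ : (Letter → Bool → Bool) → Bool
∀ᴸᴮ P = ∀ᴸ λ x → ∀ᴮ (P x)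

∀ᴸᴮ-sound : ∀ {P : Letter → Bool → Bool} → T (∀ᴸᴮ P) → ∀ x e → T (P x e)
∀ᴸᴮ-sound {P} ok x = ∀ᴮ-sound {P x} (∀ᴸ-sound {λ x → ∀ᴮ (P x)} ok x)

∀ᴸᴮ²-sound : ∀ {P : Letter → Bool → Letter → Bool → Bool} →
             T (∀ᴸᴮ λ x e → ∀ᴸᴮ (P x e)) → ∀ x e y f → T (P x e y f)
∀ᴸᴮ²-sound {P} ok x e = ∀ᴸᴮ-sound {P x e} (∀ᴸᴮ-sound {λ x e → ∀ᴸᴮ (P x e)} ok x e)

∀ᴸᴮ³-sound : ∀ {P : Letter → Bool → Letter → Bool → Letter → Bool → Bool} →
             T (∀ᴸᴮ λ x e → ∀ᴸᴮ λ y f → ∀ᴸᴮ (P x e y f)) → ∀ x e y f z g → T (P x e y f z g)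
∀ᴸᴮ³-sound {P} ok x e y f = ∀ᴸᴮ-sound {P x e y f} (∀ᴸᴮ²-sound {λ x e y f → ∀ᴸᴮ (P x e y f)} ok x e y f)

∀<ᵇ : ℕ → (ℕ → Bool) → Bool
∀<ᵇ zero    P = true
∀<ᵇ (suc n) P = ∀<ᵇ n P ∧ P n

∀<ᵇ-sound : ∀ {n} {P : ℕ → Bool} → T (∀<ᵇ n P) → ∀ t → t < n → T (P t)
∀<ᵇ-sound {suc n} {P} ok t t<1+n with m≤n⇒m<n∨m≡n (s≤s⁻¹ t<1+n)
... | inj₁ t<n  = ∀<ᵇ-sound {n} {P} (proj₁ (T-∧⁻ (∀<ᵇ n P) ok)) t t<n
... | inj₂ refl = proj₂ (T-∧⁻ (∀<ᵇ n P) ok)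

∀ᵂ : ℕ → (Word → Bool) → Bool
∀ᵂ zero    P = P []
∀ᵂ (suc k) P = ∀ᴸ λ x → ∀ᵂ k (P ∘ (x ∷_))

∀ᵂ-sound : ∀ {k} {P : Word → Bool} → T (∀ᵂ k P) → ∀ w → length w ≡ k → T (P w)
∀ᵂ-sound {zero}          ok []      _  = ok
∀ᵂ-sound {suc k} {P} ok (x ∷ w) eq =
  ∀ᵂ-sound {k} {P ∘ (x ∷_)} (∀ᴸ-sound {λ x → ∀ᵂ k (P ∘ (x ∷_))} ok x) w (suc-injective eq)

_◂_ : Bool → (ℕ → Bool) → ℕ → Bool
(b ◂ c) zero    = b
(b ◂ c) (suc l) = c l

-- all choice sequences, which P may only inspect below k
∀ᶜ : ℕ → ((ℕ → Bool) → Bool) → Bool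
∀ᶜ zero    P = P (λ _ → false)
∀ᶜ (suc k) P = ∀ᴮ λ b → ∀ᶜ k (P ∘ (b ◂_))

∀ᶜ-sound : ∀ {k} {P : (ℕ → Bool) → Bool} → (∀ {c c′} → (∀ l → l < k → c l ≡ c′ l) → P c ≡ P c′) →
           T (∀ᶜ k P) → ∀ c → T (P c)
∀ᶜ-sound {zero}      local ok c = subst T (local λ _ ()) ok
∀ᶜ-sound {suc k} {P} local ok c =
  subst T (local head-tail)
    (∀ᶜ-sound {k} {P ∘ (c 0 ◂_)} local′ (∀ᴮ-sound {λ b → ∀ᶜ k (P ∘ (b ◂_))} ok (c 0)) (c ∘ suc))
  where
  local′ : ∀ {d d′} → (∀ l → l < k → d l ≡ d′ l) → P (c 0 ◂ d) ≡ P (c 0 ◂ d′)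
  local′ eq = local λ { zero _ → refl ; (suc l) (s≤s l<k) → eq l l<k }
  head-tail : ∀ l → l < suc k → (c 0 ◂ (c ∘ suc)) l ≡ c l
  head-tail zero    _ = refl
  head-tail (suc l) _ = refl

commonPrefixᵇ : ℕ → Word → Word → Bool
commonPrefixᵇ zero    _       _       = true
commonPrefixᵇ (suc k) (x ∷ u) (y ∷ v) = x =ᴸ y ∧ commonPrefixᵇ k u v
commonPrefixᵇ (suc k) _       _       = false

CommonPrefix-∷⁺ : ∀ {k x y u v} → x ≡ y → CommonPrefix k u v → CommonPrefix (suc k) (x ∷ u) (y ∷ v)
CommonPrefix-∷⁺ x≡y (common-prefix ≤u ≤v agree) = common-prefix (s≤s ≤u) (s≤s ≤v) λ
  { zero    _        → x≡y
  ; (suc j) (s≤s j<) → agree j j< }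

CommonPrefix-∷⁻ : ∀ {k x y u v} → CommonPrefix (suc k) (x ∷ u) (y ∷ v) → x ≡ y × CommonPrefix k u v
CommonPrefix-∷⁻ (common-prefix (s≤s ≤u) (s≤s ≤v) agree) =
  agree 0 (s≤s z≤n) , common-prefix ≤u ≤v λ j j< → agree (suc j) (s≤s j<)

commonPrefixᵇ-sound : ∀ k u v → T (commonPrefixᵇ k u v) → CommonPrefix k u v
commonPrefixᵇ-sound zero    u       v       _  = common-prefix z≤n z≤n λ _ ()
commonPrefixᵇ-sound (suc k) (x ∷ u) (y ∷ v) ok = let x≡y , rest = T-∧⁻ (x =ᴸ y) ok in
  CommonPrefix-∷⁺ (=ᴸ⇒≡ x≡y) (commonPrefixᵇ-sound k u v rest)

commonPrefixᵇ-complete : ∀ k u v → CommonPrefix k u v → T (commonPrefixᵇ k u v)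
commonPrefixᵇ-complete zero    u       v       _  = _
commonPrefixᵇ-complete (suc k) []      v       (common-prefix () _ _)
commonPrefixᵇ-complete (suc k) (x ∷ u) []      (common-prefix _ () _)
commonPrefixᵇ-complete (suc k) (x ∷ u) (y ∷ v) cp = let x≡y , rest = CommonPrefix-∷⁻ cp in
  T-∧⁺ (≡⇒=ᴸ x≡y) (commonPrefixᵇ-complete k u v rest)

-- Checks the periods suc p, suc (suc p), … of w, where r = drop (suc p) w.
periodsᵇ : Word → ℕ → Word → Bool
periodsᵇ w p []      = true
periodsᵇ w p (y ∷ r) = not (commonPrefixᵇ (suc p) w (y ∷ r)) ∧ periodsᵇ w (suc p) r

drop-suc : ∀ {w : Word} {p y r} → y ∷ r ≡ drop (suc p) w → r ≡ drop (suc (suc p)) w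
drop-suc {w} {p} eq = cong (drop 1) eq ⟨ trans ⟩ drop-drop (suc p) 1 w ⟨ trans ⟩ cong (λ i → drop (suc i) w) (+-comm p 1)

periodsᵇ-sound : ∀ w p r → r ≡ drop (suc p) w → T (periodsᵇ w p r) →
                 ∀ j → ¬ CommonPrefix (suc p + j) w (drop (suc p + j) w)
periodsᵇ-sound w p []      eq _  j (common-prefix _ ≤rest _) = contradiction (subst (λ r → suc p + j ≤ length r) empty ≤rest) λ ()
  where
  empty : drop (suc p + j) w ≡ []
  empty = sym (drop-drop (suc p) j w) ⟨ trans ⟩ cong (drop j) (sym eq) ⟨ trans ⟩ drop-[] j
periodsᵇ-sound w p (y ∷ r) eq ok zero cp =
  T-not (proj₁ (T-∧⁻ _ ok)) (commonPrefixᵇ-complete (suc p) w (y ∷ r)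
    (subst₂ (λ k r → CommonPrefix k w r) (+-identityʳ (suc p)) (cong (λ k → drop k w) (+-identityʳ (suc p)) ⟨ trans ⟩ sym eq) cp))
periodsᵇ-sound w p (y ∷ r) eq ok (suc j) =
  subst (λ k → ¬ CommonPrefix k w (drop k w)) (sym (+-suc (suc p) j))
    (periodsᵇ-sound w (suc p) r (drop-suc {w} {p} eq) (proj₂ (T-∧⁻ _ ok)) j)

periodsᵇ-complete : ∀ w p r → r ≡ drop (suc p) w →
                    (∀ j → ¬ CommonPrefix (suc p + j) w (drop (suc p + j) w)) → T (periodsᵇ w p r)
periodsᵇ-complete w p []      eq none = _
periodsᵇ-complete w p (y ∷ r) eq none = T-∧⁺
  (T-not⁺ λ ok → none 0 (subst₂ (λ k r → CommonPrefix k w r) (sym (+-identityʳ (suc p)))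
                          (eq ⟨ trans ⟩ cong (λ k → drop k w) (sym (+-identityʳ (suc p))))
                          (commonPrefixᵇ-sound (suc p) w (y ∷ r) ok)))
  (periodsᵇ-complete w (suc p) r (drop-suc {w} {p} eq) λ j →
     subst (λ k → ¬ CommonPrefix k w (drop k w)) (+-suc (suc p) j) (none (suc j)))

prefixSquareFreeᵇ : Word → Bool
prefixSquareFreeᵇ w = periodsᵇ w 0 (drop 1 w)

prefixSquareFreeᵇ-sound : ∀ w → T (prefixSquareFreeᵇ w) → ∀ {p} → ¬ SquareAt w 0 p
prefixSquareFreeᵇ-sound w ok {suc j} sq = periodsᵇ-sound w 0 (drop 1 w) refl ok j (SquareAt-zero⇒CommonPrefix sq)

prefixSquareFreeᵇ-complete : ∀ w → (∀ {p} → ¬ SquareAt w 0 p) → T (prefixSquareFreeᵇ w)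
prefixSquareFreeᵇ-complete w none = periodsᵇ-complete w 0 (drop 1 w) refl λ j cp →
  none (CommonPrefix⇒SquareAt-zero (s≤s z≤n) cp)

squareFreeBeforeᵇ : ℕ → Word → Bool
squareFreeBeforeᵇ zero    _       = true
squareFreeBeforeᵇ (suc k) []      = true
squareFreeBeforeᵇ (suc k) (x ∷ w) = prefixSquareFreeᵇ (x ∷ w) ∧ squareFreeBeforeᵇ k w

squareFreeBeforeᵇ-sound : ∀ k w → T (squareFreeBeforeᵇ k w) → ∀ {s p} → s < k → ¬ SquareAt w s p
squareFreeBeforeᵇ-sound (suc k) []      _  _ (square-at p≥1 fits _) =
  contradiction (≤-trans (≤-trans p≥1 (m≤n+m _ _)) fits) λ ()
squareFreeBeforeᵇ-sound (suc k) (x ∷ w) ok {zero}  _        sq =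
  prefixSquareFreeᵇ-sound (x ∷ w) (proj₁ (T-∧⁻ _ ok)) sq
squareFreeBeforeᵇ-sound (suc k) (x ∷ w) ok {suc s} (s≤s s<) sq =
  squareFreeBeforeᵇ-sound k w (proj₂ (T-∧⁻ _ ok)) s< (SquareAt-drop⁺ 1 sq)

squareFreeBeforeᵇ-complete : ∀ k w → SquareFree w → T (squareFreeBeforeᵇ k w)
squareFreeBeforeᵇ-complete zero    _       _  = _
squareFreeBeforeᵇ-complete (suc k) []      _  = _
squareFreeBeforeᵇ-complete (suc k) (x ∷ w) sf = T-∧⁺
  (prefixSquareFreeᵇ-complete (x ∷ w) λ {p} sq → sf (Equivalence.from HasSquare⇔SquareAt (0 , p , sq)))
  (squareFreeBeforeᵇ-complete k w (SquareFree-drop 1 sf))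

squareFreeᵇ : Word → Bool
squareFreeᵇ w = squareFreeBeforeᵇ (length w) w

uniformᵇ : ChoiceMorphism → ℕ → Bool
uniformᵇ φ L = ∀ᴸᴮ λ x e → length (φ x e) ≡ᵇ L

offsetᵇ : ℕ → Word → Word → ℕ → Bool
offsetᵇ m u v zero    = true
offsetᵇ m u v (suc t) = not (commonPrefixᵇ m (drop (suc t) u) v)

offsetsᵇ : ChoiceMorphism → ℕ → ℕ → Letter → Bool → Letter → Bool → Letter → Bool → Bool
offsetsᵇ φ L m x e y f z g = x =ᴸ y ∨ ∀<ᵇ L (offsetᵇ m (φ x e ++ φ y f) (φ z g))

synchronizingᵇ : ChoiceMorphism → ℕ → ℕ → Bool
synchronizingᵇ φ L m = ∀ᴸᴮ λ x e → ∀ᴸᴮ λ y f → ∀ᴸᴮ (offsetsᵇ φ L m x e y f)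

distinctMarkersᵇ : ChoiceMorphism → ℕ → ℕ → Letter → Bool → Letter → Bool → Bool
distinctMarkersᵇ φ L h x e y f =
  not (commonPrefixᵇ h (φ x e) (φ y f)) ∧ not (commonPrefixᵇ h (drop (L ∸ h) (φ x e)) (drop (L ∸ h) (φ y f)))

markersᵇ : ChoiceMorphism → ℕ → ℕ → Bool
markersᵇ φ L h = ∀ᴸᴮ λ x e → ∀ᴸᴮ λ y f → x =ᴸ y ∨ distinctMarkersᵇ φ L h x e y f

shortImageᵇ : ChoiceMorphism → ℕ → ℕ → Word → Bool
shortImageᵇ φ L k ys = not (squareFreeᵇ ys) ∨ ∀ᶜ k λ c → squareFreeBeforeᵇ L (image φ ys c)

shortImagesᵇ : ChoiceMorphism → ℕ → Bool
shortImagesᵇ φ L = ∀<ᵇ 4 λ k → ∀ᵂ (suc k) (shortImageᵇ φ L (suc k))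

module _ (φ : ChoiceMorphism) (L : ℕ) where

  uniformᵇ-sound : T (uniformᵇ φ L) → ∀ x e → length (φ x e) ≡ L
  uniformᵇ-sound ok x e = ≡ᵇ⇒≡ (length (φ x e)) L (∀ᴸᴮ-sound {λ x e → length (φ x e) ≡ᵇ L} ok x e)

  synchronizingᵇ-sound : ∀ m → T (synchronizingᵇ φ L m) → ∀ {x y} e f z g {t} → x ≢ y → 1 ≤ t → t < L →
                         ¬ CommonPrefix m (drop t (φ x e ++ φ y f)) (φ z g)
  synchronizingᵇ-sound m ok {x} {y} e f z g {suc t} x≢y _ t<L cp =
    T-not (∀<ᵇ-sound {L} {offsetᵇ m (φ x e ++ φ y f) (φ z g)} offsets (suc t) t<L) (commonPrefixᵇ-complete m _ _ cp)
    where
    offsets : T (∀<ᵇ L (offsetᵇ m (φ x e ++ φ y f) (φ z g)))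
    offsets = T-∨-resolve (∀ᴸᴮ³-sound {offsetsᵇ φ L m} ok x e y f z g) (x≢y ∘ =ᴸ⇒≡)

  markersᵇ-sound : ∀ h → T (markersᵇ φ L h) → ∀ {x y} e f → x ≢ y →
                   ¬ CommonPrefix h (φ x e) (φ y f) × ¬ CommonPrefix h (drop (L ∸ h) (φ x e)) (drop (L ∸ h) (φ y f))
  markersᵇ-sound h ok {x} {y} e f x≢y =
    (λ cp → T-not (proj₁ markers) (commonPrefixᵇ-complete h _ _ cp)) ,
    (λ cp → T-not (proj₂ markers) (commonPrefixᵇ-complete h _ _ cp))
    where
    markers : T (not (commonPrefixᵇ h (φ x e) (φ y f))) × T (not (commonPrefixᵇ h (drop (L ∸ h) (φ x e)) (drop (L ∸ h) (φ y f))))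
    markers = T-∧⁻ (not (commonPrefixᵇ h (φ x e) (φ y f)))
      (T-∨-resolve (∀ᴸᴮ²-sound {λ x e y f → x =ᴸ y ∨ distinctMarkersᵇ φ L h x e y f} ok x e y f) (x≢y ∘ =ᴸ⇒≡))

  shortImagesᵇ-sound : T (shortImagesᵇ φ L) → ∀ ys c → 1 ≤ length ys → length ys ≤ 4 → SquareFree ys →
                       ∀ {t p} → t < L → ¬ SquareAt (image φ ys c) t p
  shortImagesᵇ-sound ok ys@(_ ∷ ys′) c _ ∣ys∣≤4 sf =
    squareFreeBeforeᵇ-sound L (image φ ys c) (∀ᶜ-sound local all-choices c)
    where
    image-T : T (shortImageᵇ φ L (length ys) ys)
    image-T = ∀ᵂ-sound {length ys} {shortImageᵇ φ L (length ys)}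
                (∀<ᵇ-sound {4} {λ k → ∀ᵂ (suc k) (shortImageᵇ φ L (suc k))} ok (length ys′) ∣ys∣≤4) ys refl
    local : ∀ {c c′} → (∀ l → l < length ys → c l ≡ c′ l) →
            squareFreeBeforeᵇ L (image φ ys c) ≡ squareFreeBeforeᵇ L (image φ ys c′)
    local eq = cong (squareFreeBeforeᵇ L) (image-cong φ ys eq)
    all-choices : T (∀ᶜ (length ys) λ c → squareFreeBeforeᵇ L (image φ ys c))
    all-choices = T-∨-resolve image-T λ not-free → T-not not-free (squareFreeBeforeᵇ-complete (length ys) ys sf)

  certify : ∀ m h → T (uniformᵇ φ L) → T (m ≤ᵇ L) → T (m + m ≤ᵇ L + 5) → T (h ≤ᵇ L) → T (h + h ≤ᵇ L + 1) →
            T (synchronizingᵇ φ L m) → T (markersᵇ φ L h) → T (shortImagesᵇ φ L) → SquareFreeCertificate φ L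
  certify m h uniform m≤L 2m≤ h≤L 2h≤ sync markers short = record
    { uniform           = uniformᵇ-sound uniform
    ; sync-length       = m
    ; marker-length     = h
    ; sync≤L            = ≤ᵇ⇒≤ m L m≤L
    ; 2sync≤L+5         = ≤ᵇ⇒≤ (m + m) (L + 5) 2m≤
    ; marker≤L          = ≤ᵇ⇒≤ h L h≤L
    ; 2marker≤L+1       = ≤ᵇ⇒≤ (h + h) (L + 1) 2h≤
    ; synchronizing     = synchronizingᵇ-sound m sync
    ; prefix-determines = λ e f cp → decidable-stable (_ Fin.≟ _) λ x≢y → proj₁ (markersᵇ-sound h markers e f x≢y) cp
    ; suffix-determines = λ e f cp → decidable-stable (_ Fin.≟ _) λ x≢y → proj₂ (markersᵇ-sound h markers e f x≢y) cp
    ; short-images      = shortImagesᵇ-sound short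
    }

-- Discrepancy and counting

count-a-++ : ∀ u v → count-a (u ++ v) ≡ count-a u + count-a v
count-a-++ []          v = refl
count-a-++ (zero  ∷ u) v = cong suc (count-a-++ u v)
count-a-++ (suc _ ∷ u) v = count-a-++ u v

count-a≤length : ∀ w → count-a w ≤ length w
count-a≤length []          = z≤n
count-a≤length (zero  ∷ w) = s≤s (count-a≤length w)
count-a≤length (suc _ ∷ w) = m≤n⇒m≤1+n (count-a≤length w)

discrepancy : ℕ → ℕ → Word → ℤ
discrepancy p q w = q * count-a w ⊖ p * length w

+-⊖-+ : ∀ a b c d → (a + b) ⊖ (c + d) ≡ (a ⊖ c) ℤ.+ (b ⊖ d)
+-⊖-+ a b c d = begin
  (a + b) ⊖ (c + d)                                  ≡⟨ ℤ.[+m]-[+n]≡m⊖n (a + b) (c + d) ⟨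
  ℤ.+_ (a + b) ℤ.- ℤ.+_ (c + d)                      ≡⟨ cong₂ ℤ._-_ (ℤ.pos-+ a b) (ℤ.pos-+ c d) ⟩
  (ℤ.+_ a ℤ.+ ℤ.+_ b) ℤ.- (ℤ.+_ c ℤ.+ ℤ.+_ d)        ≡⟨ regroup (ℤ.+_ a) (ℤ.+_ b) (ℤ.+_ c) (ℤ.+_ d) ⟩
  (ℤ.+_ a ℤ.- ℤ.+_ c) ℤ.+ (ℤ.+_ b ℤ.- ℤ.+_ d)        ≡⟨ cong₂ ℤ._+_ (ℤ.[+m]-[+n]≡m⊖n a c) (ℤ.[+m]-[+n]≡m⊖n b d) ⟩
  (a ⊖ c) ℤ.+ (b ⊖ d)                                ∎
  where
  open ≡-Reasoning
  regroup : ∀ a b c d → (a ℤ.+ b) ℤ.- (c ℤ.+ d) ≡ (a ℤ.- c) ℤ.+ (b ℤ.- d)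
  regroup = ℤ-Solver.solve-∀

discrepancy-++ : ∀ p q u v → discrepancy p q (u ++ v) ≡ discrepancy p q u ℤ.+ discrepancy p q v
discrepancy-++ p q u v = begin
  q * count-a (u ++ v) ⊖ p * length (u ++ v)
    ≡⟨ cong₂ (λ x y → q * x ⊖ p * y) (count-a-++ u v) (length-++ u) ⟩
  q * (count-a u + count-a v) ⊖ p * (length u + length v)
    ≡⟨ cong₂ _⊖_ (*-distribˡ-+ q (count-a u) (count-a v)) (*-distribˡ-+ p (length u) (length v)) ⟩
  (q * count-a u + q * count-a v) ⊖ (p * length u + p * length v)
    ≡⟨ +-⊖-+ (q * count-a u) (q * count-a v) (p * length u) (p * length v) ⟩
  discrepancy p q u ℤ.+ discrepancy p q v  ∎
  where open ≡-Reasoning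

∣⊖∣≡∣-∣ : ∀ m n → ℤ.∣ m ⊖ n ∣ ≡ ∣ m - n ∣
∣⊖∣≡∣-∣ m n with ≤-total m n
... | inj₁ m≤n = ℤ.∣⊖∣-≤ m≤n ⟨ trans ⟩ sym (m≤n⇒∣m-n∣≡n∸m m≤n)
... | inj₂ n≤m = ℤ.∣m⊖n∣≡∣n⊖m∣ m n ⟨ trans ⟩ ℤ.∣⊖∣-≤ n≤m ⟨ trans ⟩ sym (m≤n⇒∣n-m∣≡n∸m n≤m)

∣discrepancy∣≤ : ∀ p q w → ℤ.∣ discrepancy p q w ∣ ≤ (p + q) * length w
∣discrepancy∣≤ p q w = begin
  ℤ.∣ discrepancy p q w ∣                ≡⟨ ∣⊖∣≡∣-∣ (q * count-a w) (p * length w) ⟩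
  ∣ q * count-a w - p * length w ∣       ≤⟨ ∣m-n∣≤m⊔n (q * count-a w) (p * length w) ⟩
  q * count-a w ⊔ p * length w           ≤⟨ m⊔n≤m+n (q * count-a w) (p * length w) ⟩
  q * count-a w + p * length w           ≤⟨ +-monoˡ-≤ (p * length w) (*-monoʳ-≤ q (count-a≤length w)) ⟩
  q * length w + p * length w            ≡⟨ *-distribʳ-+ (length w) q p ⟨
  (q + p) * length w                     ≡⟨ cong (_* length w) (+-comm q p) ⟩
  (p + q) * length w                     ∎
  where open ≤-Reasoning

discrepancy-[] : ∀ p q → discrepancy p q [] ≡ 0ℤ
discrepancy-[] p q = cong₂ _⊖_ (*-zeroʳ q) (*-zeroʳ p)

discrepancy-image : ∀ φ {p q p′ q′} (κ₁ κ₂ : ℤ) →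
                    (∀ x e → κ₁ ℤ.* discrepancy p q (φ x e) ≡ κ₂ ℤ.* discrepancy p′ q′ (x ∷ [])) →
                    ∀ xs c → κ₁ ℤ.* discrepancy p q (image φ xs c) ≡ κ₂ ℤ.* discrepancy p′ q′ xs
discrepancy-image φ {p} {q} {p′} {q′} κ₁ κ₂ blocks [] c =
  cong (κ₁ ℤ.*_) (discrepancy-[] p q) ⟨ trans ⟩ ℤ.*-zeroʳ κ₁
    ⟨ trans ⟩ sym (ℤ.*-zeroʳ κ₂) ⟨ trans ⟩ cong (κ₂ ℤ.*_) (sym (discrepancy-[] p′ q′))
discrepancy-image φ {p} {q} {p′} {q′} κ₁ κ₂ blocks (x ∷ xs) c = begin
  κ₁ ℤ.* discrepancy p q (φ x (c 0) ++ image φ xs (c ∘ suc))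
    ≡⟨ cong (κ₁ ℤ.*_) (discrepancy-++ p q (φ x (c 0)) _) ⟩
  κ₁ ℤ.* (discrepancy p q (φ x (c 0)) ℤ.+ discrepancy p q (image φ xs (c ∘ suc)))
    ≡⟨ ℤ.*-distribˡ-+ κ₁ _ _ ⟩
  κ₁ ℤ.* discrepancy p q (φ x (c 0)) ℤ.+ κ₁ ℤ.* discrepancy p q (image φ xs (c ∘ suc))
    ≡⟨ cong₂ ℤ._+_ (blocks x (c 0)) (discrepancy-image φ {p} {q} {p′} {q′} κ₁ κ₂ blocks xs (c ∘ suc)) ⟩
  κ₂ ℤ.* discrepancy p′ q′ (x ∷ []) ℤ.+ κ₂ ℤ.* discrepancy p′ q′ xs
    ≡⟨ ℤ.*-distribˡ-+ κ₂ _ _ ⟨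
  κ₂ ℤ.* (discrepancy p′ q′ (x ∷ []) ℤ.+ discrepancy p′ q′ xs)
    ≡⟨ cong (κ₂ ℤ.*_) (discrepancy-++ p′ q′ (x ∷ []) xs) ⟨
  κ₂ ℤ.* discrepancy p′ q′ (x ∷ xs) ∎
  where open ≡-Reasoning

allChoices : ∀ i → List (Vec Bool i)
allChoices zero    = [] ∷ []
allChoices (suc i) = map (false ∷_) (allChoices i) ++ map (true ∷_) (allChoices i)

length-allChoices : ∀ i → length (allChoices i) ≡ 2 ^ i
length-allChoices zero    = refl
length-allChoices (suc i) = begin
  length (map (false ∷_) (allChoices i) ++ map (true ∷_) (allChoices i))  ≡⟨ length-++ (map (false ∷_) (allChoices i)) ⟩
  length (map (false ∷_) (allChoices i)) + length (map (true ∷_) (allChoices i))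
    ≡⟨ cong₂ _+_ (length-map _ (allChoices i)) (length-map _ (allChoices i)) ⟩
  length (allChoices i) + length (allChoices i)                            ≡⟨ cong (λ k → k + k) (length-allChoices i) ⟩
  2 ^ i + 2 ^ i                                                            ≡⟨ cong (λ k → 2 ^ i + k) (+-identityʳ (2 ^ i)) ⟨
  2 ^ suc i                                                                ∎
  where open ≡-Reasoning

allChoices-unique : ∀ i → Unique (allChoices i)
allChoices-unique zero    = All.[] ∷ []
allChoices-unique (suc i) =
  Unique.++⁺ (Unique.map⁺ Vec.∷-injectiveʳ (allChoices-unique i)) (Unique.map⁺ Vec.∷-injectiveʳ (allChoices-unique i)) disjoint
  where
  disjoint : ∀ {v} → ¬ (v ∈ map (false ∷_) (allChoices i) × v ∈ map (true ∷_) (allChoices i))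
  disjoint (∈false , ∈true) with ∈-map⁻ (false ∷_) ∈false | ∈-map⁻ (true ∷_) ∈true
  ... | _ , _ , refl | _ , _ , ()

choice : ∀ {i} → Vec Bool i → ℕ → Bool
choice []      _       = false
choice (b ∷ v) zero    = b
choice (b ∷ v) (suc l) = choice v l

choice-injective : ∀ {i} (v v′ : Vec Bool i) → (∀ l → l < i → choice v l ≡ choice v′ l) → v ≡ v′
choice-injective []      []        _  = refl
choice-injective (b ∷ v) (b′ ∷ v′) eq =
  cong₂ _∷_ (eq 0 (s≤s z≤n)) (choice-injective v v′ λ l l< → eq (suc l) (s≤s l<))

++-cancelʳ-length : {A : Set} (u u′ : List A) {v v′ : List A} → length u ≡ length u′ → u ++ v ≡ u′ ++ v′ → u ≡ u′
++-cancelʳ-length []      []        _  _  = refl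
++-cancelʳ-length (x ∷ u) (x′ ∷ u′) eq eq′ =
  cong₂ _∷_ (List.∷-injectiveˡ eq′) (++-cancelʳ-length u u′ (suc-injective eq) (List.∷-injectiveʳ eq′))

image-injective : ∀ φ {L} → (∀ x e → length (φ x e) ≡ L) → (∀ x → φ x false ≢ φ x true) →
                  ∀ xs {c c′} → image φ xs c ≡ image φ xs c′ → ∀ l → l < length xs → c l ≡ c′ l
image-injective φ uniform distinct (x ∷ xs) {c} {c′} eq zero    _        =
  choice-determined (c 0) (c′ 0) (++-cancelʳ-length (φ x (c 0)) _ (uniform x (c 0) ⟨ trans ⟩ sym (uniform x (c′ 0))) eq)
  where
  choice-determined : ∀ e e′ → φ x e ≡ φ x e′ → e ≡ e′
  choice-determined false false _  = refl
  choice-determined true  true  _  = refl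
  choice-determined false true  eq = contradiction eq (distinct x)
  choice-determined true  false eq = contradiction (sym eq) (distinct x)
image-injective φ uniform distinct (x ∷ xs) {c} {c′} eq (suc l) (s≤s l<) =
  image-injective φ uniform distinct xs
    (List.++-cancelˡ (φ x (c 0)) _ _ (eq ⟨ trans ⟩ cong (_++ image φ xs (c′ ∘ suc)) (sym same-block))) l l<
  where
  same-block : φ x (c 0) ≡ φ x (c′ 0)
  same-block = cong (φ x) (image-injective φ uniform distinct (x ∷ xs) {c} {c′} eq zero (s≤s z≤n))

[m*n]^k≡m^k*n^k : ∀ m n k → (m * n) ^ k ≡ m ^ k * n ^ k
[m*n]^k≡m^k*n^k m n zero    = refl
[m*n]^k≡m^k*n^k m n (suc k) = cong (m * n *_) ([m*n]^k≡m^k*n^k m n k) ⟨ trans ⟩ regroup m n (m ^ k) (n ^ k)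
  where
  regroup : ∀ m n x y → m * n * (x * y) ≡ m * x * (n * y)
  regroup = solve-∀

exponential-growth : ∀ k M i n → n ≤ M * i → suc (suc k) ^ M ≤ 2 * suc k ^ M → suc (suc k) ^ n ≤ 2 ^ i * suc k ^ n
exponential-growth k M i n n≤ rate = *-cancelʳ-≤ (suc (suc k) ^ n) (2 ^ i * suc k ^ n) (suc k ^ e) {{m^n≢0 (suc k) e}} (begin
  suc (suc k) ^ n * suc k ^ e           ≤⟨ *-monoʳ-≤ (suc (suc k) ^ n) (^-monoˡ-≤ e (n≤1+n (suc k))) ⟩
  suc (suc k) ^ n * suc (suc k) ^ e     ≡⟨ ^-distribˡ-+-* (suc (suc k)) n e ⟨
  suc (suc k) ^ (n + e)                 ≡⟨ cong (suc (suc k) ^_) n+e≡ ⟩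
  suc (suc k) ^ (M * i)                 ≡⟨ ^-*-assoc (suc (suc k)) M i ⟨
  (suc (suc k) ^ M) ^ i                 ≤⟨ ^-monoˡ-≤ i rate ⟩
  (2 * suc k ^ M) ^ i                   ≡⟨ [m*n]^k≡m^k*n^k 2 (suc k ^ M) i ⟩
  2 ^ i * (suc k ^ M) ^ i               ≡⟨ cong (2 ^ i *_) (^-*-assoc (suc k) M i ⟨ trans ⟩ cong (suc k ^_) (sym n+e≡)) ⟩
  2 ^ i * suc k ^ (n + e)               ≡⟨ cong (2 ^ i *_) (^-distribˡ-+-* (suc k) n e) ⟩
  2 ^ i * (suc k ^ n * suc k ^ e)       ≡⟨ *-assoc (2 ^ i) (suc k ^ n) (suc k ^ e) ⟨
  2 ^ i * suc k ^ n * suc k ^ e         ∎)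
  where
  open ≤-Reasoning
  e : ℕ
  e = M * i ∸ n
  n+e≡ : n + e ≡ M * i
  n+e≡ = m+[n∸m]≡n n≤

n<m^n : ∀ {m} → 2 ≤ m → ∀ n → n < m ^ n
n<m^n 2≤m zero    = s≤s z≤n
n<m^n {m} 2≤m (suc n) = begin-strict
  suc n          ≤⟨ n<m^n 2≤m n ⟩
  m ^ n          <⟨ m<m+n (m ^ n) (≤-trans (s≤s z≤n) (n<m^n 2≤m n)) ⟩
  m ^ n + m ^ n  ≡⟨ cong (λ k → m ^ n + k) (+-identityʳ (m ^ n)) ⟨
  2 * m ^ n      ≤⟨ *-monoˡ-≤ (m ^ n) 2≤m ⟩
  m * m ^ n      ∎
  where open ≤-Reasoning

-- Square-free words with a given frequency of a

prefix-of-balanced-image : ∀ {φ L ρ} .{{_ : NonZero L}} →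
                           (∀ x e → length (φ x e) ≡ L) → (∀ x e → discrepancy ρ L (φ x e) ≡ 0ℤ) →
                           ∀ w c k → k < length w * L → ℤ.∣ discrepancy ρ L (take k (image φ w c)) ∣ ≤ (ρ + L) * L
prefix-of-balanced-image {φ} {L} {ρ} uniform balanced w c k k< = begin
  ℤ.∣ discrepancy ρ L (take k (image φ w c)) ∣                ≡⟨ cong (ℤ.∣_∣ ∘ discrepancy ρ L) split ⟩
  ℤ.∣ discrepancy ρ L (image φ (take i w) c ++ partial) ∣     ≡⟨ cong ℤ.∣_∣ only-partial ⟩
  ℤ.∣ discrepancy ρ L partial ∣                               ≤⟨ ∣discrepancy∣≤ ρ L partial ⟩
  (ρ + L) * length partial                                    ≤⟨ *-monoʳ-≤ (ρ + L) ∣partial∣≤L ⟩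
  (ρ + L) * L                                                 ∎
  where
  open ≤-Reasoning
  open Uniform φ L uniform
  i : ℕ
  i = k / L
  r : ℕ
  r = k % L
  partial : Word
  partial = take r (φ (w ! i) (c i))
  ∣partial∣≤L : length partial ≤ L
  ∣partial∣≤L = ≤-trans (≤-reflexive (length-take r _)) (≤-trans (m⊓n≤m r _) (<⇒≤ (m%n<n k L)))
  split : take k (image φ w c) ≡ image φ (take i w) c ++ partial
  split = cong (λ k → take k (image φ w c)) (block-coordinates L k)
            ⟨ trans ⟩ take-image-partial i w c (block-index-< L (block-coordinates L k) k<) (<⇒≤ (m%n<n k L))
  image-balanced : discrepancy ρ L (image φ (take i w) c) ≡ 0ℤ
  image-balanced = sym (ℤ.*-identityˡ _)
    ⟨ trans ⟩ discrepancy-image φ {ρ} {L} {ρ} {L} 1ℤ 0ℤ (λ x e → ℤ.*-identityˡ _ ⟨ trans ⟩ balanced x e) (take i w) c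
  only-partial : discrepancy ρ L (image φ (take i w) c ++ partial) ≡ discrepancy ρ L partial
  only-partial = discrepancy-++ ρ L (image φ (take i w) c) partial
    ⟨ trans ⟩ cong (ℤ._+ discrepancy ρ L partial) image-balanced ⟨ trans ⟩ ℤ.+-identityˡ (discrepancy ρ L partial)

-- The words of length n are the prefixes of length n of g(z), for all choices, where z is a prefix of
-- length n / Lg + 1 of an iterate h^k(a); their number is 2 ^ (n / Lg).
module FrequencyWords
  (p q : ℕ) .{{_ : NonZero q}}
  {g : ChoiceMorphism} {Lg : ℕ} .{{_ : NonZero Lg}} (g-certificate : SquareFreeCertificate g Lg)
  (g-distinct : ∀ x → g x false ≢ g x true)
  {h : ChoiceMorphism} {Lh : ℕ} (h-certificate : SquareFreeCertificate h Lh) (2≤Lh : 2 ≤ Lh)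
  (ρ : ℕ) (h-balanced : ∀ x e → discrepancy ρ Lh (h x e) ≡ 0ℤ)
  (d : ℕ) .{{_ : NonZero d}} (κ : ℤ)
  (g-scales : ∀ x e → discrepancy (d * p) (d * q) (g x e) ≡ κ ℤ.* discrepancy ρ Lh (x ∷ []))
  where

  private
    instance
      Lh-nonZero : NonZero Lh
      Lh-nonZero = >-nonZero (≤-trans (s≤s z≤n) 2≤Lh)

  open SquareFreeCertificate g-certificate using () renaming (uniform to g-uniform)
  open SquareFreeCertificate h-certificate using () renaming (uniform to h-uniform)

  h-power : ℕ → Word
  h-power zero    = a ∷ []
  h-power (suc k) = image h (h-power k) (λ _ → false)

  h-power-squareFree : ∀ k → SquareFree (h-power k)
  h-power-squareFree zero    = single-letter-squareFree a
  h-power-squareFree (suc k) = SquareFreeness.image-squareFree h-certificate _ (h-power-squareFree k)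

  length-h-power : ∀ k → length (h-power k) ≡ Lh ^ k
  length-h-power zero    = refl
  length-h-power (suc k) =
    Uniform.length-image h Lh h-uniform (h-power k) _ ⟨ trans ⟩ cong (_* Lh) (length-h-power k) ⟨ trans ⟩ *-comm (Lh ^ k) Lh

  source : ℕ → Word
  source i = take (suc i) (h-power (suc i))

  i<∣h-power∣ : ∀ i → i < length (h-power i)
  i<∣h-power∣ i = subst (i <_) (sym (length-h-power i)) (n<m^n 2≤Lh i)

  length-source : ∀ i → length (source i) ≡ suc i
  length-source i = length-take-≤ (suc i) (h-power (suc i)) (<⇒≤ (i<∣h-power∣ (suc i)))

  source-discrepancy : ∀ i → ℤ.∣ discrepancy ρ Lh (take i (source i)) ∣ ≤ (ρ + Lh) * Lh
  source-discrepancy i = subst (λ w → ℤ.∣ discrepancy ρ Lh w ∣ ≤ (ρ + Lh) * Lh) (sym prefix)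
    (prefix-of-balanced-image {h} {Lh} {ρ} h-uniform h-balanced (h-power i) (λ _ → false) i (<-≤-trans (i<∣h-power∣ i) (m≤m*n _ Lh)))
    where
    prefix : take i (source i) ≡ take i (h-power (suc i))
    prefix = take-take i (suc i) _ ⟨ trans ⟩ cong (λ k → take k (h-power (suc i))) (m≤n⇒m⊓n≡m (n≤1+n i))

  discrepancy-bound : ℕ
  discrepancy-bound = ℤ.∣ κ ∣ * ((ρ + Lh) * Lh) + (d * p + d * q) * Lg

  module OfLength (n : ℕ) where
    i : ℕ
    i = n / Lg
    r : ℕ
    r = n % Lg

    n≡ : n ≡ i * Lg + r
    n≡ = block-coordinates Lg n

    word : Vec Bool i → Word
    word v = take n (image g (source i) (choice v))

    length-word : ∀ v → length (word v) ≡ n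
    length-word v = length-take-≤ n _ (begin
      n                                       ≡⟨ n≡ ⟩
      i * Lg + r                              ≤⟨ +-monoʳ-≤ (i * Lg) (<⇒≤ (m%n<n n Lg)) ⟩
      i * Lg + Lg                             ≡⟨ +-comm (i * Lg) Lg ⟩
      suc i * Lg                              ≡⟨ cong (_* Lg) (length-source i) ⟨
      length (source i) * Lg                  ≡⟨ Uniform.length-image g Lg g-uniform (source i) (choice v) ⟨
      length (image g (source i) (choice v))  ∎)
      where open ≤-Reasoning

    word-squareFree : ∀ v → SquareFree (word v)
    word-squareFree v = SquareFree-take n
      (SquareFreeness.image-squareFree g-certificate (choice v) (SquareFree-take (suc i) (h-power-squareFree (suc i))))

    length-prefix : length (take i (source i)) ≡ i
    length-prefix = length-take-≤ i (source i) (subst (i ≤_) (sym (length-source i)) (n≤1+n i))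

    split : ∀ v → word v ≡ image g (take i (source i)) (choice v) ++ take r (g (source i ! i) (choice v i))
    split v = cong (λ k → take k (image g (source i) (choice v))) n≡
      ⟨ trans ⟩ Uniform.take-image-partial g Lg g-uniform i (source i) (choice v)
                  (subst (i <_) (sym (length-source i)) (n<1+n i)) (<⇒≤ (m%n<n n Lg))

    word-injective : ∀ {v v′} → word v ≡ word v′ → v ≡ v′
    word-injective {v} {v′} eq = choice-injective v v′ λ l l<i →
      image-injective g g-uniform g-distinct (take i (source i)) same-images l (subst (l <_) (sym length-prefix) l<i)
      where
      same-length : ∀ v → length (image g (take i (source i)) (choice v)) ≡ i * Lg
      same-length v = Uniform.length-image g Lg g-uniform (take i (source i)) (choice v) ⟨ trans ⟩ cong (_* Lg) length-prefix
      same-images : image g (take i (source i)) (choice v) ≡ image g (take i (source i)) (choice v′)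
      same-images = ++-cancelʳ-length _ _ (same-length v ⟨ trans ⟩ sym (same-length v′))
                      (sym (split v) ⟨ trans ⟩ eq ⟨ trans ⟩ split v′)

    word-discrepancy : ∀ v → ∣ q * count-a (word v) - p * n ∣ ≤ discrepancy-bound
    word-discrepancy v = begin
      ∣ q * X - p * n ∣
        ≤⟨ m≤n*m _ d ⟩
      d * ∣ q * X - p * n ∣
        ≡⟨ *-distribˡ-∣-∣ d (q * X) (p * n) ⟩
      ∣ d * (q * X) - d * (p * n) ∣
        ≡⟨ cong₂ ∣_-_∣ (*-assoc d q X) (cong (d * p *_) (length-word v) ⟨ trans ⟩ *-assoc d p n) ⟨
      ∣ d * q * X - d * p * length (word v) ∣
        ≡⟨ ∣⊖∣≡∣-∣ (d * q * X) (d * p * length (word v)) ⟨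
      ℤ.∣ D (word v) ∣
        ≡⟨ cong (ℤ.∣_∣ ∘ D) (split v) ⟩
      ℤ.∣ D (image g prefix (choice v) ++ partial) ∣
        ≡⟨ cong ℤ.∣_∣ (discrepancy-++ (d * p) (d * q) (image g prefix (choice v)) partial) ⟩
      ℤ.∣ D (image g prefix (choice v)) ℤ.+ D partial ∣
        ≤⟨ ℤ.∣i+j∣≤∣i∣+∣j∣ (D (image g prefix (choice v))) (D partial) ⟩
      ℤ.∣ D (image g prefix (choice v)) ∣ + ℤ.∣ D partial ∣
        ≡⟨ cong (λ z → ℤ.∣ z ∣ + ℤ.∣ D partial ∣) image-part ⟩
      ℤ.∣ κ ℤ.* discrepancy ρ Lh prefix ∣ + ℤ.∣ D partial ∣
        ≡⟨ cong (_+ ℤ.∣ D partial ∣) (ℤ.abs-* κ (discrepancy ρ Lh prefix)) ⟩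
      ℤ.∣ κ ∣ * ℤ.∣ discrepancy ρ Lh prefix ∣ + ℤ.∣ D partial ∣
        ≤⟨ +-mono-≤ (*-monoʳ-≤ ℤ.∣ κ ∣ (source-discrepancy i)) partial-bound ⟩
      discrepancy-bound ∎
      where
      open ≤-Reasoning
      X : ℕ
      X = count-a (word v)
      D : Word → ℤ
      D = discrepancy (d * p) (d * q)
      prefix : Word
      prefix = take i (source i)
      partial : Word
      partial = take r (g (source i ! i) (choice v i))
      image-part : D (image g prefix (choice v)) ≡ κ ℤ.* discrepancy ρ Lh prefix
      image-part = sym (ℤ.*-identityˡ _)
        ⟨ trans ⟩ discrepancy-image g {d * p} {d * q} {ρ} {Lh} 1ℤ κ (λ x e → ℤ.*-identityˡ _ ⟨ trans ⟩ g-scales x e)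
                                    prefix (choice v)
      partial-bound : ℤ.∣ D partial ∣ ≤ (d * p + d * q) * Lg
      partial-bound = ≤-trans (∣discrepancy∣≤ (d * p) (d * q) partial)
        (*-monoʳ-≤ (d * p + d * q) (≤-trans (≤-reflexive (length-take r _)) (≤-trans (m⊓n≤m r _) (<⇒≤ (m%n<n n Lg)))))

  positive-entropy : ∀ k → suc (suc k) ^ (2 * Lg) ≤ 2 * suc k ^ (2 * Lg) → PositiveEntropy p q
  positive-entropy k rate = k , λ m → suc (Lg + discrepancy-bound * suc m) , λ n N≤n → at-least m n N≤n
    where
    at-least : ∀ m n → suc (Lg + discrepancy-bound * suc m) ≤ n → ∃[ B ] (AtLeast p q m n B × suc (suc k) ^ n ≤ B * suc k ^ n)
    at-least m n N≤n =
      2 ^ i , (map word (allChoices i) , Unique.map⁺ word-injective (allChoices-unique i) , All.map⁺ (All.universal good _) , count)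
            , exponential-growth k (2 * Lg) i n (n≤2L[n/L] Lg (<-≤-trans (s≤s (m≤m+n Lg _)) N≤n)) rate
      where
      open OfLength n
      count : 2 ^ i ≤ length (map word (allChoices i))
      count = ≤-reflexive (sym (length-map word (allChoices i) ⟨ trans ⟩ length-allChoices i))
      good : ∀ v → Good p q m n (word v)
      good v = length-word v , word-squareFree v , (begin-strict
        ∣ q * count-a (word v) - p * n ∣ * suc m   ≤⟨ *-monoˡ-≤ (suc m) (word-discrepancy v) ⟩
        discrepancy-bound * suc m                  <⟨ <-≤-trans (s≤s (m≤n+m (discrepancy-bound * suc m) Lg)) N≤n ⟩
        n                                          ≤⟨ m≤n*m n q ⟩
        q * n                                      ∎)
        where open ≤-Reasoning

-- The thirteen frequencies

by-letters : {P : Letter → Set} → P zero → P (suc zero) → P (suc (suc zero)) → ∀ x → P x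
by-letters pa pb pc zero             = pa
by-letters pa pb pc (suc zero)       = pb
by-letters pa pb pc (suc (suc zero)) = pc

by-blocks : {P : Letter → Bool → Set} → P zero false → P zero true → P (suc zero) false → P (suc zero) true →
            P (suc (suc zero)) false → P (suc (suc zero)) true → ∀ x e → P x e
by-blocks pa₀ pa₁ pb₀ pb₁ pc₀ pc₁ =
  by-letters (λ { false → pa₀ ; true → pa₁ }) (λ { false → pb₀ ; true → pb₁ }) (λ { false → pc₀ ; true → pc₁ })

b c : Letter
b = suc zero
c = suc (suc zero)

φ24 : ChoiceMorphism
φ24 zero false = a ∷ c ∷ a ∷ b ∷ a ∷ c ∷ b ∷ a ∷ b ∷ c ∷ b ∷ a ∷ c ∷ a ∷ b ∷ c ∷ a ∷ c ∷ b ∷ c ∷ a ∷ b ∷ c ∷ b ∷ []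
φ24 zero true = a ∷ c ∷ a ∷ b ∷ a ∷ c ∷ b ∷ c ∷ a ∷ c ∷ b ∷ a ∷ b ∷ c ∷ a ∷ b ∷ a ∷ c ∷ b ∷ c ∷ a ∷ b ∷ c ∷ b ∷ []
φ24 (suc zero) false = a ∷ b ∷ c ∷ a ∷ b ∷ a ∷ c ∷ b ∷ a ∷ b ∷ c ∷ b ∷ a ∷ c ∷ b ∷ c ∷ a ∷ b ∷ a ∷ c ∷ a ∷ b ∷ c ∷ b ∷ []
φ24 (suc zero) true = a ∷ c ∷ a ∷ b ∷ c ∷ a ∷ c ∷ b ∷ a ∷ b ∷ c ∷ b ∷ a ∷ c ∷ b ∷ c ∷ a ∷ b ∷ a ∷ c ∷ a ∷ b ∷ c ∷ b ∷ []
φ24 (suc (suc zero)) false = a ∷ b ∷ c ∷ a ∷ b ∷ a ∷ c ∷ b ∷ c ∷ a ∷ c ∷ b ∷ a ∷ c ∷ a ∷ b ∷ a ∷ c ∷ b ∷ c ∷ a ∷ b ∷ c ∷ b ∷ []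
φ24 (suc (suc zero)) true = a ∷ b ∷ c ∷ a ∷ c ∷ b ∷ a ∷ c ∷ a ∷ b ∷ a ∷ c ∷ b ∷ a ∷ b ∷ c ∷ a ∷ c ∷ b ∷ c ∷ a ∷ b ∷ c ∷ b ∷ []

φ28 : ChoiceMorphism
φ28 zero false = b ∷ c ∷ b ∷ a ∷ c ∷ a ∷ b ∷ a ∷ c ∷ b ∷ c ∷ a ∷ c ∷ b ∷ a ∷ b ∷ c ∷ b ∷ a ∷ c ∷ b ∷ c ∷ a ∷ c ∷ b ∷ a ∷ c ∷ a ∷ []
φ28 zero true = b ∷ c ∷ b ∷ a ∷ b ∷ c ∷ a ∷ b ∷ a ∷ c ∷ b ∷ c ∷ a ∷ c ∷ b ∷ a ∷ b ∷ c ∷ b ∷ a ∷ c ∷ b ∷ c ∷ a ∷ b ∷ a ∷ c ∷ a ∷ []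
φ28 (suc zero) false = b ∷ c ∷ b ∷ a ∷ b ∷ c ∷ a ∷ c ∷ b ∷ a ∷ c ∷ a ∷ b ∷ a ∷ c ∷ b ∷ c ∷ a ∷ c ∷ b ∷ a ∷ b ∷ c ∷ a ∷ c ∷ b ∷ c ∷ a ∷ []
φ28 (suc zero) true = b ∷ c ∷ b ∷ a ∷ b ∷ c ∷ a ∷ c ∷ b ∷ c ∷ a ∷ b ∷ a ∷ c ∷ b ∷ c ∷ a ∷ c ∷ b ∷ a ∷ c ∷ a ∷ b ∷ a ∷ c ∷ b ∷ c ∷ a ∷ []
φ28 (suc (suc zero)) false = b ∷ c ∷ b ∷ a ∷ b ∷ c ∷ a ∷ c ∷ b ∷ a ∷ b ∷ c ∷ b ∷ a ∷ c ∷ b ∷ c ∷ a ∷ c ∷ b ∷ a ∷ b ∷ c ∷ a ∷ b ∷ a ∷ c ∷ a ∷ []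
φ28 (suc (suc zero)) true = b ∷ c ∷ b ∷ a ∷ c ∷ b ∷ c ∷ a ∷ c ∷ b ∷ a ∷ b ∷ c ∷ b ∷ a ∷ c ∷ a ∷ b ∷ c ∷ a ∷ c ∷ b ∷ c ∷ a ∷ b ∷ a ∷ c ∷ a ∷ []

φ29 : ChoiceMorphism
φ29 zero false = c ∷ b ∷ c ∷ a ∷ b ∷ a ∷ c ∷ a ∷ b ∷ c ∷ a ∷ c ∷ b ∷ a ∷ b ∷ c ∷ b ∷ a ∷ c ∷ a ∷ b ∷ a ∷ c ∷ b ∷ a ∷ b ∷ c ∷ b ∷ a ∷ []
φ29 zero true = c ∷ b ∷ c ∷ a ∷ b ∷ a ∷ c ∷ a ∷ b ∷ c ∷ a ∷ c ∷ b ∷ a ∷ c ∷ a ∷ b ∷ a ∷ c ∷ b ∷ c ∷ a ∷ c ∷ b ∷ a ∷ b ∷ c ∷ b ∷ a ∷ []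
φ29 (suc zero) false = c ∷ b ∷ c ∷ a ∷ b ∷ a ∷ c ∷ a ∷ b ∷ c ∷ a ∷ c ∷ b ∷ c ∷ a ∷ b ∷ c ∷ b ∷ a ∷ b ∷ c ∷ a ∷ c ∷ b ∷ a ∷ c ∷ a ∷ b ∷ a ∷ []
φ29 (suc zero) true = c ∷ b ∷ c ∷ a ∷ b ∷ a ∷ c ∷ a ∷ b ∷ c ∷ b ∷ a ∷ c ∷ a ∷ b ∷ a ∷ c ∷ b ∷ c ∷ a ∷ c ∷ b ∷ a ∷ c ∷ a ∷ b ∷ c ∷ b ∷ a ∷ []
φ29 (suc (suc zero)) false = c ∷ b ∷ c ∷ a ∷ b ∷ c ∷ b ∷ a ∷ b ∷ c ∷ a ∷ b ∷ a ∷ c ∷ a ∷ b ∷ c ∷ b ∷ a ∷ c ∷ a ∷ b ∷ a ∷ c ∷ b ∷ a ∷ b ∷ c ∷ a ∷ []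
φ29 (suc (suc zero)) true = c ∷ b ∷ c ∷ a ∷ b ∷ a ∷ c ∷ a ∷ b ∷ c ∷ b ∷ a ∷ b ∷ c ∷ a ∷ c ∷ b ∷ a ∷ c ∷ a ∷ b ∷ a ∷ c ∷ b ∷ a ∷ b ∷ c ∷ b ∷ a ∷ []

φ29a : ChoiceMorphism
φ29a zero false = a ∷ c ∷ b ∷ c ∷ a ∷ c ∷ b ∷ a ∷ b ∷ c ∷ a ∷ b ∷ a ∷ c ∷ a ∷ b ∷ c ∷ a ∷ c ∷ b ∷ c ∷ a ∷ b ∷ a ∷ c ∷ a ∷ b ∷ c ∷ b ∷ []
φ29a zero true = a ∷ c ∷ a ∷ b ∷ c ∷ b ∷ a ∷ b ∷ c ∷ a ∷ c ∷ b ∷ a ∷ c ∷ a ∷ b ∷ a ∷ c ∷ b ∷ c ∷ a ∷ c ∷ b ∷ a ∷ c ∷ a ∷ b ∷ c ∷ b ∷ []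
φ29a (suc zero) false = a ∷ c ∷ b ∷ c ∷ a ∷ b ∷ c ∷ b ∷ a ∷ b ∷ c ∷ a ∷ c ∷ b ∷ a ∷ c ∷ a ∷ b ∷ c ∷ b ∷ a ∷ b ∷ c ∷ a ∷ c ∷ b ∷ c ∷ a ∷ b ∷ []
φ29a (suc zero) true = a ∷ c ∷ b ∷ c ∷ a ∷ b ∷ c ∷ b ∷ a ∷ b ∷ c ∷ a ∷ c ∷ b ∷ a ∷ b ∷ c ∷ b ∷ a ∷ c ∷ a ∷ b ∷ c ∷ a ∷ c ∷ b ∷ c ∷ a ∷ b ∷ []
φ29a (suc (suc zero)) false = a ∷ c ∷ b ∷ c ∷ a ∷ c ∷ b ∷ a ∷ b ∷ c ∷ b ∷ a ∷ c ∷ a ∷ b ∷ c ∷ a ∷ c ∷ b ∷ c ∷ a ∷ b ∷ c ∷ b ∷ a ∷ b ∷ c ∷ a ∷ b ∷ []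
φ29a (suc (suc zero)) true = a ∷ c ∷ b ∷ c ∷ a ∷ c ∷ b ∷ a ∷ b ∷ c ∷ b ∷ a ∷ c ∷ b ∷ c ∷ a ∷ b ∷ a ∷ c ∷ a ∷ b ∷ c ∷ a ∷ c ∷ b ∷ a ∷ b ∷ c ∷ b ∷ []

φ29b : ChoiceMorphism
φ29b zero false = a ∷ c ∷ b ∷ a ∷ b ∷ c ∷ a ∷ c ∷ b ∷ c ∷ a ∷ b ∷ c ∷ b ∷ a ∷ c ∷ b ∷ c ∷ a ∷ c ∷ b ∷ a ∷ c ∷ a ∷ b ∷ a ∷ c ∷ b ∷ c ∷ []
φ29b zero true = a ∷ c ∷ b ∷ a ∷ b ∷ c ∷ b ∷ a ∷ c ∷ a ∷ b ∷ c ∷ a ∷ c ∷ b ∷ c ∷ a ∷ b ∷ c ∷ b ∷ a ∷ b ∷ c ∷ a ∷ b ∷ a ∷ c ∷ b ∷ c ∷ []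
φ29b (suc zero) false = a ∷ c ∷ b ∷ a ∷ b ∷ c ∷ a ∷ c ∷ b ∷ c ∷ a ∷ b ∷ a ∷ c ∷ a ∷ b ∷ c ∷ b ∷ a ∷ c ∷ b ∷ c ∷ a ∷ c ∷ b ∷ a ∷ c ∷ a ∷ b ∷ []
φ29b (suc zero) true = a ∷ c ∷ b ∷ a ∷ b ∷ c ∷ b ∷ a ∷ c ∷ a ∷ b ∷ c ∷ b ∷ a ∷ b ∷ c ∷ a ∷ b ∷ a ∷ c ∷ a ∷ b ∷ c ∷ a ∷ c ∷ b ∷ c ∷ a ∷ b ∷ []
φ29b (suc (suc zero)) false = a ∷ c ∷ b ∷ a ∷ b ∷ c ∷ b ∷ a ∷ c ∷ a ∷ b ∷ a ∷ c ∷ b ∷ c ∷ a ∷ b ∷ c ∷ b ∷ a ∷ b ∷ c ∷ a ∷ c ∷ b ∷ a ∷ c ∷ a ∷ b ∷ []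
φ29b (suc (suc zero)) true = a ∷ c ∷ b ∷ a ∷ b ∷ c ∷ a ∷ b ∷ a ∷ c ∷ a ∷ b ∷ c ∷ b ∷ a ∷ c ∷ a ∷ b ∷ a ∷ c ∷ b ∷ a ∷ b ∷ c ∷ b ∷ a ∷ c ∷ b ∷ c ∷ []

φ32 : ChoiceMorphism
φ32 zero false = b ∷ c ∷ a ∷ c ∷ b ∷ c ∷ a ∷ b ∷ c ∷ b ∷ a ∷ c ∷ b ∷ c ∷ a ∷ c ∷ b ∷ a ∷ c ∷ a ∷ b ∷ a ∷ c ∷ b ∷ a ∷ b ∷ c ∷ a ∷ b ∷ a ∷ c ∷ a ∷ []
φ32 zero true = b ∷ c ∷ b ∷ a ∷ b ∷ c ∷ a ∷ c ∷ b ∷ a ∷ b ∷ c ∷ b ∷ a ∷ c ∷ a ∷ b ∷ a ∷ c ∷ b ∷ a ∷ b ∷ c ∷ a ∷ c ∷ b ∷ c ∷ a ∷ b ∷ a ∷ c ∷ a ∷ []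
φ32 (suc zero) false = b ∷ c ∷ a ∷ c ∷ b ∷ a ∷ b ∷ c ∷ a ∷ b ∷ a ∷ c ∷ b ∷ c ∷ a ∷ b ∷ c ∷ b ∷ a ∷ c ∷ a ∷ b ∷ a ∷ c ∷ b ∷ a ∷ b ∷ c ∷ b ∷ a ∷ c ∷ a ∷ []
φ32 (suc zero) true = b ∷ c ∷ a ∷ c ∷ b ∷ a ∷ b ∷ c ∷ a ∷ b ∷ a ∷ c ∷ b ∷ a ∷ b ∷ c ∷ a ∷ c ∷ b ∷ c ∷ a ∷ b ∷ a ∷ c ∷ b ∷ a ∷ b ∷ c ∷ b ∷ a ∷ c ∷ a ∷ []
φ32 (suc (suc zero)) false = b ∷ c ∷ b ∷ a ∷ b ∷ c ∷ a ∷ c ∷ b ∷ c ∷ a ∷ b ∷ a ∷ c ∷ b ∷ c ∷ a ∷ c ∷ b ∷ a ∷ c ∷ a ∷ b ∷ a ∷ c ∷ b ∷ c ∷ a ∷ b ∷ a ∷ c ∷ a ∷ []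
φ32 (suc (suc zero)) true = b ∷ c ∷ a ∷ c ∷ b ∷ a ∷ c ∷ a ∷ b ∷ c ∷ b ∷ a ∷ b ∷ c ∷ a ∷ b ∷ a ∷ c ∷ b ∷ a ∷ b ∷ c ∷ b ∷ a ∷ c ∷ b ∷ c ∷ a ∷ b ∷ a ∷ c ∷ a ∷ []

φ32a : ChoiceMorphism
φ32a zero false = c ∷ b ∷ c ∷ a ∷ b ∷ c ∷ b ∷ a ∷ c ∷ b ∷ c ∷ a ∷ c ∷ b ∷ a ∷ c ∷ a ∷ b ∷ a ∷ c ∷ b ∷ a ∷ b ∷ c ∷ a ∷ c ∷ b ∷ a ∷ c ∷ a ∷ b ∷ a ∷ []
φ32a zero true = c ∷ b ∷ c ∷ a ∷ c ∷ b ∷ a ∷ b ∷ c ∷ a ∷ c ∷ b ∷ c ∷ a ∷ b ∷ a ∷ c ∷ a ∷ b ∷ c ∷ a ∷ c ∷ b ∷ a ∷ b ∷ c ∷ b ∷ a ∷ c ∷ a ∷ b ∷ a ∷ []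
φ32a (suc zero) false = c ∷ b ∷ c ∷ a ∷ b ∷ c ∷ b ∷ a ∷ c ∷ b ∷ c ∷ a ∷ b ∷ a ∷ c ∷ a ∷ b ∷ c ∷ a ∷ c ∷ b ∷ c ∷ a ∷ b ∷ c ∷ b ∷ a ∷ b ∷ c ∷ a ∷ b ∷ a ∷ []
φ32a (suc zero) true = c ∷ b ∷ c ∷ a ∷ b ∷ c ∷ b ∷ a ∷ c ∷ b ∷ c ∷ a ∷ b ∷ a ∷ c ∷ a ∷ b ∷ c ∷ b ∷ a ∷ c ∷ b ∷ c ∷ a ∷ b ∷ c ∷ b ∷ a ∷ c ∷ a ∷ b ∷ a ∷ []
φ32a (suc (suc zero)) false = c ∷ b ∷ c ∷ a ∷ b ∷ c ∷ b ∷ a ∷ c ∷ b ∷ c ∷ a ∷ b ∷ a ∷ c ∷ b ∷ a ∷ b ∷ c ∷ b ∷ a ∷ c ∷ b ∷ c ∷ a ∷ c ∷ b ∷ a ∷ c ∷ a ∷ b ∷ a ∷ []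
φ32a (suc (suc zero)) true = c ∷ b ∷ c ∷ a ∷ b ∷ c ∷ b ∷ a ∷ b ∷ c ∷ a ∷ c ∷ b ∷ c ∷ a ∷ b ∷ a ∷ c ∷ b ∷ c ∷ a ∷ c ∷ b ∷ a ∷ b ∷ c ∷ b ∷ a ∷ c ∷ a ∷ b ∷ a ∷ []

φ32b : ChoiceMorphism
φ32b zero false = a ∷ c ∷ b ∷ c ∷ a ∷ c ∷ b ∷ a ∷ c ∷ a ∷ b ∷ c ∷ b ∷ a ∷ b ∷ c ∷ a ∷ b ∷ a ∷ c ∷ b ∷ a ∷ b ∷ c ∷ a ∷ c ∷ b ∷ c ∷ a ∷ b ∷ c ∷ b ∷ []
φ32b zero true = a ∷ c ∷ b ∷ c ∷ a ∷ c ∷ b ∷ a ∷ b ∷ c ∷ a ∷ b ∷ a ∷ c ∷ b ∷ a ∷ b ∷ c ∷ b ∷ a ∷ c ∷ a ∷ b ∷ c ∷ a ∷ c ∷ b ∷ c ∷ a ∷ b ∷ c ∷ b ∷ []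
φ32b (suc zero) false = a ∷ c ∷ b ∷ c ∷ a ∷ b ∷ a ∷ c ∷ b ∷ a ∷ b ∷ c ∷ a ∷ c ∷ b ∷ a ∷ c ∷ a ∷ b ∷ c ∷ a ∷ c ∷ b ∷ c ∷ a ∷ b ∷ a ∷ c ∷ a ∷ b ∷ c ∷ b ∷ []
φ32b (suc zero) true = a ∷ c ∷ a ∷ b ∷ c ∷ a ∷ c ∷ b ∷ a ∷ b ∷ c ∷ a ∷ b ∷ a ∷ c ∷ a ∷ b ∷ c ∷ b ∷ a ∷ b ∷ c ∷ a ∷ b ∷ a ∷ c ∷ b ∷ c ∷ a ∷ b ∷ c ∷ b ∷ []
φ32b (suc (suc zero)) false = a ∷ b ∷ c ∷ a ∷ b ∷ a ∷ c ∷ a ∷ b ∷ c ∷ a ∷ c ∷ b ∷ c ∷ a ∷ b ∷ a ∷ c ∷ b ∷ a ∷ b ∷ c ∷ a ∷ b ∷ a ∷ c ∷ b ∷ c ∷ a ∷ b ∷ c ∷ b ∷ []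
φ32b (suc (suc zero)) true = a ∷ c ∷ a ∷ b ∷ a ∷ c ∷ b ∷ a ∷ b ∷ c ∷ b ∷ a ∷ c ∷ a ∷ b ∷ c ∷ a ∷ c ∷ b ∷ a ∷ b ∷ c ∷ a ∷ b ∷ a ∷ c ∷ b ∷ c ∷ a ∷ b ∷ c ∷ b ∷ []

φ34 : ChoiceMorphism
φ34 zero false = b ∷ c ∷ a ∷ c ∷ b ∷ c ∷ a ∷ b ∷ c ∷ b ∷ a ∷ b ∷ c ∷ a ∷ b ∷ a ∷ c ∷ a ∷ b ∷ c ∷ b ∷ a ∷ c ∷ a ∷ b ∷ a ∷ c ∷ b ∷ c ∷ a ∷ b ∷ a ∷ c ∷ a ∷ []
φ34 zero true = b ∷ c ∷ a ∷ c ∷ b ∷ c ∷ a ∷ b ∷ a ∷ c ∷ b ∷ c ∷ a ∷ c ∷ b ∷ a ∷ c ∷ a ∷ b ∷ a ∷ c ∷ b ∷ a ∷ b ∷ c ∷ a ∷ b ∷ a ∷ c ∷ a ∷ b ∷ c ∷ b ∷ a ∷ []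
φ34 (suc zero) false = b ∷ c ∷ a ∷ c ∷ b ∷ a ∷ c ∷ a ∷ b ∷ c ∷ b ∷ a ∷ b ∷ c ∷ a ∷ b ∷ a ∷ c ∷ a ∷ b ∷ c ∷ a ∷ c ∷ b ∷ c ∷ a ∷ b ∷ a ∷ c ∷ a ∷ b ∷ c ∷ b ∷ a ∷ []
φ34 (suc zero) true = b ∷ c ∷ a ∷ c ∷ b ∷ c ∷ a ∷ b ∷ a ∷ c ∷ b ∷ c ∷ a ∷ c ∷ b ∷ a ∷ b ∷ c ∷ b ∷ a ∷ c ∷ a ∷ b ∷ a ∷ c ∷ b ∷ a ∷ b ∷ c ∷ a ∷ b ∷ a ∷ c ∷ a ∷ []
φ34 (suc (suc zero)) false = b ∷ c ∷ a ∷ c ∷ b ∷ c ∷ a ∷ b ∷ a ∷ c ∷ b ∷ a ∷ b ∷ c ∷ a ∷ c ∷ b ∷ a ∷ c ∷ a ∷ b ∷ c ∷ a ∷ c ∷ b ∷ a ∷ b ∷ c ∷ a ∷ b ∷ a ∷ c ∷ b ∷ a ∷ []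
φ34 (suc (suc zero)) true = b ∷ c ∷ a ∷ c ∷ b ∷ a ∷ c ∷ a ∷ b ∷ a ∷ c ∷ b ∷ a ∷ b ∷ c ∷ b ∷ a ∷ c ∷ a ∷ b ∷ a ∷ c ∷ b ∷ c ∷ a ∷ c ∷ b ∷ a ∷ b ∷ c ∷ b ∷ a ∷ c ∷ a ∷ []

φ51 : ChoiceMorphism
φ51 zero false = c ∷ b ∷ a ∷ b ∷ c ∷ a ∷ c ∷ b ∷ c ∷ a ∷ b ∷ c ∷ b ∷ a ∷ b ∷ c ∷ a ∷ c ∷ b ∷ a ∷ c ∷ a ∷ b ∷ c ∷ a ∷ c ∷ b ∷ a ∷ b ∷ c ∷ b ∷ a ∷ c ∷ a ∷ b ∷ c ∷ b ∷ a ∷ b ∷ c ∷ a ∷ b ∷ a ∷ c ∷ b ∷ c ∷ a ∷ b ∷ c ∷ b ∷ a ∷ []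
φ51 zero true = c ∷ b ∷ a ∷ b ∷ c ∷ b ∷ a ∷ c ∷ b ∷ c ∷ a ∷ c ∷ b ∷ a ∷ c ∷ a ∷ b ∷ c ∷ b ∷ a ∷ c ∷ b ∷ c ∷ a ∷ b ∷ c ∷ b ∷ a ∷ b ∷ c ∷ a ∷ b ∷ a ∷ c ∷ b ∷ a ∷ b ∷ c ∷ b ∷ a ∷ c ∷ a ∷ b ∷ c ∷ b ∷ a ∷ b ∷ c ∷ a ∷ b ∷ a ∷ []
φ51 (suc zero) false = c ∷ b ∷ c ∷ a ∷ c ∷ b ∷ a ∷ c ∷ a ∷ b ∷ a ∷ c ∷ b ∷ a ∷ b ∷ c ∷ a ∷ c ∷ b ∷ c ∷ a ∷ b ∷ c ∷ b ∷ a ∷ c ∷ b ∷ c ∷ a ∷ c ∷ b ∷ a ∷ b ∷ c ∷ b ∷ a ∷ c ∷ a ∷ b ∷ c ∷ b ∷ a ∷ b ∷ c ∷ a ∷ c ∷ b ∷ c ∷ a ∷ b ∷ a ∷ []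
φ51 (suc zero) true = c ∷ b ∷ c ∷ a ∷ c ∷ b ∷ a ∷ b ∷ c ∷ b ∷ a ∷ c ∷ b ∷ c ∷ a ∷ b ∷ a ∷ c ∷ a ∷ b ∷ c ∷ b ∷ a ∷ b ∷ c ∷ a ∷ c ∷ b ∷ a ∷ b ∷ c ∷ b ∷ a ∷ c ∷ a ∷ b ∷ c ∷ a ∷ c ∷ b ∷ c ∷ a ∷ b ∷ c ∷ b ∷ a ∷ b ∷ c ∷ a ∷ b ∷ a ∷ []
φ51 (suc (suc zero)) false = c ∷ b ∷ c ∷ a ∷ c ∷ b ∷ a ∷ b ∷ c ∷ a ∷ c ∷ b ∷ c ∷ a ∷ b ∷ c ∷ b ∷ a ∷ b ∷ c ∷ a ∷ c ∷ b ∷ a ∷ c ∷ a ∷ b ∷ a ∷ c ∷ b ∷ c ∷ a ∷ b ∷ c ∷ b ∷ a ∷ b ∷ c ∷ a ∷ c ∷ b ∷ c ∷ a ∷ b ∷ c ∷ b ∷ a ∷ c ∷ a ∷ b ∷ a ∷ []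
φ51 (suc (suc zero)) true = c ∷ b ∷ c ∷ a ∷ c ∷ b ∷ a ∷ b ∷ c ∷ b ∷ a ∷ c ∷ a ∷ b ∷ c ∷ b ∷ a ∷ b ∷ c ∷ a ∷ b ∷ a ∷ c ∷ b ∷ a ∷ b ∷ c ∷ b ∷ a ∷ c ∷ b ∷ c ∷ a ∷ c ∷ b ∷ a ∷ c ∷ a ∷ b ∷ c ∷ b ∷ a ∷ b ∷ c ∷ a ∷ c ∷ b ∷ c ∷ a ∷ b ∷ a ∷ []


φ24-certificate : SquareFreeCertificate φ24 24
φ24-certificate = certify φ24 24 12 12 _ _ _ _ _ _ _ _

φ28-certificate : SquareFreeCertificate φ28 28
φ28-certificate = certify φ28 28 14 14 _ _ _ _ _ _ _ _

φ29-certificate : SquareFreeCertificate φ29 29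
φ29-certificate = certify φ29 29 14 15 _ _ _ _ _ _ _ _

φ29a-certificate : SquareFreeCertificate φ29a 29
φ29a-certificate = certify φ29a 29 14 15 _ _ _ _ _ _ _ _

φ29b-certificate : SquareFreeCertificate φ29b 29
φ29b-certificate = certify φ29b 29 14 15 _ _ _ _ _ _ _ _

φ32-certificate : SquareFreeCertificate φ32 32
φ32-certificate = certify φ32 32 16 16 _ _ _ _ _ _ _ _

φ32a-certificate : SquareFreeCertificate φ32a 32
φ32a-certificate = certify φ32a 32 16 16 _ _ _ _ _ _ _ _

φ32b-certificate : SquareFreeCertificate φ32b 32
φ32b-certificate = certify φ32b 32 16 16 _ _ _ _ _ _ _ _

φ34-certificate : SquareFreeCertificate φ34 34
φ34-certificate = certify φ34 34 17 17 _ _ _ _ _ _ _ _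

φ51-certificate : SquareFreeCertificate φ51 51
φ51-certificate = certify φ51 51 25 26 _ _ _ _ _ _ _ _

φ24-balanced : ∀ x e → discrepancy 8 24 (φ24 x e) ≡ 0ℤ
φ24-balanced = by-blocks refl refl refl refl refl refl

φ28-balanced : ∀ x e → discrepancy 9 28 (φ28 x e) ≡ 0ℤ
φ28-balanced = by-blocks refl refl refl refl refl refl

φ29-balanced : ∀ x e → discrepancy 10 29 (φ29 x e) ≡ 0ℤ
φ29-balanced = by-blocks refl refl refl refl refl refl

φ32-balanced : ∀ x e → discrepancy 11 32 (φ32 x e) ≡ 0ℤ
φ32-balanced = by-blocks refl refl refl refl refl refl

-- Each frequency p / q equals (α ρ + β (Lh − ρ)) / (Lg Lh), where the images of a under g contain α letters a,
-- those of b and c contain β, and every block of h contains ρ. Then d = Lg Lh / q and κ = Lg (α − β); the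
-- growth rate 201 / 200 is reached since (201 / 200) ^ (2 · 51) < 2.
entropy-16/51 : PositiveEntropy 16 51
entropy-16/51 = FrequencyWords.positive-entropy 16 51
  φ51-certificate (by-letters (λ ()) (λ ()) (λ ())) φ24-certificate (s≤s (s≤s z≤n)) 8 φ24-balanced
  24 0ℤ (by-blocks refl refl refl refl refl refl) 199 (≤ᵇ⇒≤ _ _ _)

entropy-9/28 : PositiveEntropy 9 28
entropy-9/28 = FrequencyWords.positive-entropy 9 28
  φ28-certificate (by-letters (λ ()) (λ ()) (λ ())) φ28-certificate (s≤s (s≤s z≤n)) 9 φ28-balanced
  28 0ℤ (by-blocks refl refl refl refl refl refl) 199 (≤ᵇ⇒≤ _ _ _)

entropy-28/87 : PositiveEntropy 28 87
entropy-28/87 = FrequencyWords.positive-entropy 28 87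
  φ29a-certificate (by-letters (λ ()) (λ ()) (λ ())) φ24-certificate (s≤s (s≤s z≤n)) 8 φ24-balanced
  8 (29 * 10 ⊖ 29 * 9) (by-blocks refl refl refl refl refl refl) 199 (≤ᵇ⇒≤ _ _ _)

entropy-271/841 : PositiveEntropy 271 841
entropy-271/841 = FrequencyWords.positive-entropy 271 841
  φ29a-certificate (by-letters (λ ()) (λ ()) (λ ())) φ29-certificate (s≤s (s≤s z≤n)) 10 φ29-balanced
  1 (29 * 10 ⊖ 29 * 9) (by-blocks refl refl refl refl refl refl) 199 (≤ᵇ⇒≤ _ _ _)

entropy-31/96 : PositiveEntropy 31 96
entropy-31/96 = FrequencyWords.positive-entropy 31 96
  φ32a-certificate (by-letters (λ ()) (λ ()) (λ ())) φ24-certificate (s≤s (s≤s z≤n)) 8 φ24-balanced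
  8 (32 * 11 ⊖ 32 * 10) (by-blocks refl refl refl refl refl refl) 199 (≤ᵇ⇒≤ _ _ _)

entropy-331/1024 : PositiveEntropy 331 1024
entropy-331/1024 = FrequencyWords.positive-entropy 331 1024
  φ32a-certificate (by-letters (λ ()) (λ ()) (λ ())) φ32-certificate (s≤s (s≤s z≤n)) 11 φ32-balanced
  1 (32 * 11 ⊖ 32 * 10) (by-blocks refl refl refl refl refl refl) 199 (≤ᵇ⇒≤ _ _ _)

entropy-280/841 : PositiveEntropy 280 841
entropy-280/841 = FrequencyWords.positive-entropy 280 841
  φ29b-certificate (by-letters (λ ()) (λ ()) (λ ())) φ29-certificate (s≤s (s≤s z≤n)) 10 φ29-balanced
  1 (29 * 9 ⊖ 29 * 10) (by-blocks refl refl refl refl refl refl) 199 (≤ᵇ⇒≤ _ _ _)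

entropy-341/1024 : PositiveEntropy 341 1024
entropy-341/1024 = FrequencyWords.positive-entropy 341 1024
  φ32b-certificate (by-letters (λ ()) (λ ()) (λ ())) φ32-certificate (s≤s (s≤s z≤n)) 11 φ32-balanced
  1 (32 * 10 ⊖ 32 * 11) (by-blocks refl refl refl refl refl refl) 199 (≤ᵇ⇒≤ _ _ _)

entropy-1/3 : PositiveEntropy 1 3
entropy-1/3 = FrequencyWords.positive-entropy 1 3
  φ24-certificate (by-letters (λ ()) (λ ()) (λ ())) φ24-certificate (s≤s (s≤s z≤n)) 8 φ24-balanced
  192 0ℤ (by-blocks refl refl refl refl refl refl) 199 (≤ᵇ⇒≤ _ _ _)

entropy-271/812 : PositiveEntropy 271 812
entropy-271/812 = FrequencyWords.positive-entropy 271 812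
  φ29b-certificate (by-letters (λ ()) (λ ()) (λ ())) φ28-certificate (s≤s (s≤s z≤n)) 9 φ28-balanced
  1 (29 * 9 ⊖ 29 * 10) (by-blocks refl refl refl refl refl refl) 199 (≤ᵇ⇒≤ _ _ _)

entropy-11/32 : PositiveEntropy 11 32
entropy-11/32 = FrequencyWords.positive-entropy 11 32
  φ32-certificate (by-letters (λ ()) (λ ()) (λ ())) φ32-certificate (s≤s (s≤s z≤n)) 11 φ32-balanced
  32 0ℤ (by-blocks refl refl refl refl refl refl) 199 (≤ᵇ⇒≤ _ _ _)

entropy-10/29 : PositiveEntropy 10 29
entropy-10/29 = FrequencyWords.positive-entropy 10 29
  φ29-certificate (by-letters (λ ()) (λ ()) (λ ())) φ29-certificate (s≤s (s≤s z≤n)) 10 φ29-balanced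
  29 0ℤ (by-blocks refl refl refl refl refl refl) 199 (≤ᵇ⇒≤ _ _ _)

entropy-6/17 : PositiveEntropy 6 17
entropy-6/17 = FrequencyWords.positive-entropy 6 17
  φ34-certificate (by-letters (λ ()) (λ ()) (λ ())) φ24-certificate (s≤s (s≤s z≤n)) 8 φ24-balanced
  48 0ℤ (by-blocks refl refl refl refl refl refl) 199 (≤ᵇ⇒≤ _ _ _)

all-frequencies : All (uncurry PositiveEntropy) freqs
all-frequencies =
    entropy-16/51
  ∷ entropy-9/28
  ∷ entropy-28/87
  ∷ entropy-271/841
  ∷ entropy-31/96
  ∷ entropy-331/1024
  ∷ entropy-280/841
  ∷ entropy-341/1024
  ∷ entropy-1/3
  ∷ entropy-271/812
  ∷ entropy-11/32
  ∷ entropy-10/29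
  ∷ entropy-6/17
  ∷ []

lemma2 : ∀ {p q : ℕ} → (p , q) ∈ freqs → PositiveEntropy p q
lemma2 = All.lookup all-frequencies
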